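{- Let $G$ be a connected circle graph with $n$ vertices, where $n\geq 2$. Then \[P_G^{\times}(z)=a_1z+a_2z^2+\cdots+a_nz^n \quad\text{with } a_i\neq 0 \text{ for all } 1\leq i\leq n\] if and only if $G$ is a complete graph.
   Context: A ribbon graph $G$ is a surface with boundary formed from vertex discs and edge discs (ribbons), each edge attached to vertex discs along two disjoint arcs; $v,e,f,c$ denote the numbers of vertices, edges, boundary components and connected components, and the Euler genus is $\varepsilon=2c-v+e-f$. For $A\subseteq E(G)$, the partial Petrial $G^{\times|A}$ is obtained by adding a half-twist to each edge in $A$, and ${^\partial\varepsilon^{\times}_{G}(z)}=\sum_{A\subseteq E(G)} z^{\varepsilon(G^{\times|A})}$. A bouquet is a ribbon graph with one vertex; two loops are interlaced if their ends alternate around the vertex boundary; the intersection graph $I(B)$ of a bouquet $B$ has vertex set $E(B)$ with adjacency meaning interlaced. A circle graph is a graph of the form $I(B)$ for some bouquet $B$. For a circle graph $G$, $P_G^{\times}(z):={^\partial\varepsilon^{\times}_{B}(z)}$ where $B$ is any bouquet with $I(B)=G$ (this does not depend on the choice of $B$). -}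

module Defs where

open import Data.Nat using (ℕ; zero; suc; _+_; _*_; _∸_; _≤_; _<_; _<ᵇ_; _≤ᵇ_)
open import Data.Nat.DivMod using (_mod_)
open import Data.Bool using (Bool; T?; true; false; not; _∧_; _∨_; _xor_; if_then_else_)
open import Data.Fin using (Fin; toℕ)
open import Data.Product using (_×_; _,_; proj₁; proj₂)
open import Data.List using (List; []; _∷_; map; concatMap; length; filter; allFin; upTo)
open import Data.Bool.ListAction using (and)
open import Data.Vec using (Vec; []; _∷_; lookup)
open import Relation.Binary.PropositionalEquality using (_≡_; _≢_)
open import Relation.Nullary.Decidable using (⌊_⌋)
import Data.Nat as ℕ

record Graph (n : ℕ) : Set where
  field
    adj     : Fin n → Fin n → Bool
    adj-sym : ∀ i j → adj i j ≡ adj j i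
    irrefl  : ∀ i → adj i i ≡ false

open Graph public

data Reachable {n : ℕ} (G : Graph n) : Fin n → Fin n → Set where
  here : ∀ {i} → Reachable G i i
  step : ∀ {i j k} → adj G i j ≡ true → Reachable G j k → Reachable G i k

Connected : ∀ {n} → Graph n → Set
Connected G = ∀ i j → Reachable G i j

Complete : ∀ {n} → Graph n → Set
Complete G = ∀ i j → i ≢ j → adj G i j ≡ true

-- Bouquets (one-vertex ribbon graphs) with n edges, as signed chord
-- diagrams.  The 2n edge ends are placed at positions 0 .. 2n-1 in cyclic
-- order around the boundary of the single vertex disc.  An end is a pair
-- (edge i, which end b).  'word' and 'pos' are mutually inverse
-- bijections between positions and ends; 'twisted i' says whether edge i
-- carries a half-twist (relative to the vertex disc lying in the plane).

record Bouquet (n : ℕ) : Set where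
  field
    word     : Fin (n + n) → Fin n × Bool
    pos      : Fin n × Bool → Fin (n + n)
    word-pos : ∀ x → word (pos x) ≡ x
    pos-word : ∀ p → pos (word p) ≡ p
    twisted  : Fin n → Bool

open Bouquet public

-- Two distinct loops i, j are interlaced iff exactly one end of j lies
-- strictly between the two ends of i (their ends alternate).
strictlyBetween : ℕ → ℕ → ℕ → Bool
strictlyBetween x a b =
  ((a <ᵇ x) ∧ (x <ᵇ b)) ∨ ((b <ᵇ x) ∧ (x <ᵇ a))

interlaced : ∀ {n} → Bouquet n → Fin n → Fin n → Bool
interlaced B i j =
  strictlyBetween (toℕ (pos B (j , false))) p q xor
  strictlyBetween (toℕ (pos B (j , true))) p q
  where
  p = toℕ (pos B (i , false))
  q = toℕ (pos B (i , true))

partialPetrial : ∀ {n} → Bouquet n → Vec Bool n → Bouquet n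
partialPetrial B A = record
  { word = word B ; pos = pos B ; word-pos = word-pos B ; pos-word = pos-word B
  ; twisted = λ i → twisted B i xor lookup A i }

-- Each edge end at position p has two corners on
-- the vertex boundary: its left corner (false) and right corner (true).
-- The boundary of the ribbon graph is the union of
--  * vertex-boundary arcs: right corner of p  ——  left corner of p+1 (mod 2n)
--  * edge sides: for the edge with ends p, q:
--      untwisted: R(p) —— L(q), L(p) —— R(q)
--      twisted:   R(p) —— R(q), L(p) —— L(q)
-- Every corner lies on exactly one arc and one edge side, so the boundary
-- components are the connected components (cycles) of this 2-regular graph.

data Corner (n : ℕ) : Set where
  corner : Fin (n + n) → Bool → Corner n

nextF : ∀ {m} → Fin m → Fin m
nextF {zero} ()
nextF {suc m} p = suc (toℕ p) mod suc m

prevF : ∀ {m} → Fin m → Fin m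
prevF {zero} ()
prevF {suc m} p = (toℕ p + m) mod suc m

arcMove : ∀ {n} → Corner n → Corner n
arcMove (corner p true)  = corner (nextF p) false
arcMove (corner p false) = corner (prevF p) true

edgeMove : ∀ {n} → Bouquet n → Corner n → Corner n
edgeMove B (corner p s) with word B p
... | (i , b) = corner (pos B (i , not b)) (if twisted B i then s else not s)

traverse : ∀ {n} → Bouquet n → Corner n → Corner n
traverse B c = edgeMove B (arcMove c)

iterate : ∀ {A : Set} → (A → A) → ℕ → A → A
iterate f zero    x = x
iterate f (suc k) x = f (iterate f k x)

cornerKey : ∀ {n} → Corner n → ℕ
cornerKey (corner p s) = 2 * toℕ p + (if s then 1 else 0)

allCorners : (n : ℕ) → List (Corner n)
allCorners n = concatMap (λ p → corner p false ∷ corner p true ∷ []) (allFin (n + n))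

-- c is the key-minimal corner of its boundary component; the component
-- of c is { traverse^k c } ∪ { arcMove (traverse^k c) }, k < 4n.
isComponentMin : ∀ {n} → Bouquet n → Corner n → Bool
isComponentMin {n} B c =
  and (map (λ k → (cornerKey c ≤ᵇ cornerKey (iterate (traverse B) k c)) ∧
                  (cornerKey c ≤ᵇ cornerKey (arcMove (iterate (traverse B) k c))))
           (upTo (4 * n)))

faces : ∀ {n} → Bouquet n → ℕ
faces {n} B = length (filter (λ c → T? (isComponentMin B c)) (allCorners n))

-- Euler genus ε = 2c - v + e - f with c = 1, v = 1, e = n
-- (always f ≤ n + 1, so the truncated subtraction is exact).
eulerGenus : ∀ {n} → Bouquet n → ℕ
eulerGenus {n} B = (2 + n) ∸ (1 + faces B)

subsets : (n : ℕ) → List (Vec Bool n)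
subsets zero    = [] ∷ []
subsets (suc n) = concatMap (λ A → (false ∷ A) ∷ (true ∷ A) ∷ []) (subsets n)

-- Coefficient of z^k in  ∂ε^×_B(z) = Σ_{A ⊆ E(B)} z^{ε(B^{×|A})}
petrialCoeff : ∀ {n} → Bouquet n → ℕ → ℕ
petrialCoeff {n} B k =
  length (filter (λ A → eulerGenus (partialPetrial B A) ℕ.≟ k) (subsets n))

FullForm : (ℕ → ℕ) → ℕ → Set
FullForm a n =
  (a 0 ≡ 0) × ((k : ℕ) → n < k → a k ≡ 0) × ((k : ℕ) → 1 ≤ k → k ≤ n → a k ≢ 0)

-- For a bouquet with n loops the Euler genus is n + 1 − f, where the f boundary components are
-- the orbits of the corners under the arc move τ and the edge move σ.  If G is connected and
-- n ≥ 2, no loop has adjacent ends (such a loop would be an isolated vertex of G).  Then every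
-- boundary component of every partial Petrial contains the four distinct corners c, τc, στc and
-- τστc, so 1 ≤ f ≤ n and all exponents lie between 1 and n.
--
-- If the coefficient of z is non-zero, some partial Petrial has f = n: every boundary component
-- has exactly four corners, i.e. (στ)² = 1.  Read around the vertex, this says that the partner
-- map commutes with the cyclic shift (the reversing alternative forces a loop with adjacent
-- ends), so every loop joins opposite positions p and p + n.  Such diameters pairwise interlace,
-- hence G is complete.
--
-- Conversely, if G is complete, every other loop has exactly one end strictly between the two
-- ends of a given loop, so again all loops are diameters.  Twisting exactly the diameters whose
-- lower end is at least s leaves one long boundary component and n − 1 − s components with four
-- corners, i.e. Euler genus s + 1, for every s < n.

module Submission where

open import Defs
open import Data.Bool using (Bool; true; false; not; _∧_; _xor_; if_then_else_; T)
open import Data.Bool.Properties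
  using (not-involutive; not-injective; T-≡; T-∧; ∧-zeroʳ; ∨-comm; xor-same; xor-comm; xor-assoc)
open import Data.Fin as Fin using (Fin; toℕ; fromℕ<)
open import Data.Fin.Properties
  using (toℕ-fromℕ<; toℕ-injective; toℕ<n; pigeonhole; injective⇒≤; punchInᵢ≢i; punchIn-injective; punchOut-injective)
open import Data.List using (List; []; _∷_; upTo; length; filter; map; concatMap; allFin; lookup)
import Data.List as List
open import Data.List.Properties using (filter-accept; filter-reject; filter-none; map-tabulate)
open import Data.List.Membership.Propositional using (_∈_)
open import Data.List.Membership.Propositional.Properties
  using (∈-upTo⁺; ∈-lookup; ∈-filter⁺; ∈-filter⁻; ∈-concat⁺′; ∈-concat⁻′; ∈-map⁺; ∈-map⁻)
open import Data.List.Relation.Binary.Disjoint.Propositional using (Disjoint)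
open import Data.List.Relation.Unary.All as All using (All; []; _∷_)
import Data.List.Relation.Unary.All.Properties as All
open import Data.List.Relation.Unary.All.Properties using (all⁺; all⁻; all-filter)
open import Data.List.Relation.Unary.AllPairs as AllPairs using (AllPairs; []; _∷_)
import Data.List.Relation.Unary.AllPairs.Properties as AllPairs
open import Data.List.Relation.Unary.Any using (here; there)
open import Data.List.Relation.Unary.Unique.Propositional using (Unique)
import Data.List.Relation.Unary.Unique.Propositional.Properties as Unique
open import Data.Nat using (ℕ; zero; suc; _+_; _*_; _∸_; _≤_; _<_; _<ᵇ_; _≤ᵇ_; _≡ᵇ_; _≟_; _≤?_; _<?_; z≤n; s≤s; _%_)
open import Data.Nat.DivMod using (_/_; m<n⇒m%n≡m; n%n≡0; [m+n]%n≡m%n; m%n<n; m≡m%n+[m/n]*n)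
open import Data.Nat.ListAction using (sum)
open import Data.Nat.Properties
open import Data.Nat.Solver using (module +-*-Solver)
open import Data.Product using (_×_; _,_; proj₁; proj₂; ∃; ∃-syntax)
open import Data.Sum using (_⊎_; inj₁; inj₂)
open import Data.Vec using (Vec; []; _∷_; tabulate) renaming (lookup to lookupᵛ)
open import Data.Vec.Properties using (lookup∘tabulate)
open import Function using (_∘_; id; Equivalence; _⇔_; mk⇔)
open import Relation.Binary using (tri<; tri≈; tri>)
open import Relation.Binary.PropositionalEquality
open import Relation.Nullary using (¬_; yes; no; Dec; contradiction)
open import Relation.Nullary.Decidable using (T?; map′)

open +-*-Solver using (solve; _:+_; _:*_; _:=_; con)

<ᵇ-true : ∀ {a b} → a < b → (a <ᵇ b) ≡ true
<ᵇ-true a<b = Equivalence.to T-≡ (<⇒<ᵇ a<b)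

<ᵇ-false : ∀ {a b} → b ≤ a → (a <ᵇ b) ≡ false
<ᵇ-false {a} {b} b≤a with a <ᵇ b in eq
... | false = refl
... | true  = contradiction b≤a (<⇒≱ (<ᵇ⇒< a b (subst T (sym eq) _)))

≤ᵇ-true : ∀ {a b} → a ≤ b → (a ≤ᵇ b) ≡ true
≤ᵇ-true a≤b = Equivalence.to T-≡ (≤⇒≤ᵇ a≤b)

≤ᵇ-false : ∀ {a b} → b < a → (a ≤ᵇ b) ≡ false
≤ᵇ-false {a} {b} b<a with a ≤ᵇ b in eq
... | false = refl
... | true  = contradiction (≤ᵇ⇒≤ a b (subst T (sym eq) _)) (<⇒≱ b<a)

¬T⇒≡false : ∀ {b} → ¬ T b → b ≡ false
¬T⇒≡false {false} _  = refl
¬T⇒≡false {true}  ¬t = contradiction _ ¬t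

≡-or-≡not : ∀ a b → b ≡ a ⊎ b ≡ not a
≡-or-≡not false false = inj₁ refl
≡-or-≡not false true  = inj₂ refl
≡-or-≡not true  false = inj₂ refl
≡-or-≡not true  true  = inj₁ refl

xor-true⇒ : ∀ a b → a xor b ≡ true → a ≡ true ⊎ b ≡ true
xor-true⇒ true  _ _  = inj₁ refl
xor-true⇒ false _ eq = inj₂ eq

bit : Bool → ℕ
bit b = if b then 1 else 0

bit≤1 : ∀ b → bit b ≤ 1
bit≤1 true  = ≤-refl
bit≤1 false = z≤n

doubled-< : ∀ {a a′} b b′ → a < a′ → 2 * a + bit b < 2 * a′ + bit b′
doubled-< {a} {a′} b b′ a<a′ = begin-strict
  2 * a + bit b     ≤⟨ +-monoʳ-≤ (2 * a) (bit≤1 b) ⟩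
  2 * a + 1         ≡⟨ +-comm _ 1 ⟩
  suc (2 * a)       <⟨ n<1+n _ ⟩
  2 + 2 * a         ≡⟨ sym (*-suc 2 a) ⟩
  2 * suc a         ≤⟨ *-monoʳ-≤ 2 a<a′ ⟩
  2 * a′            ≤⟨ m≤m+n _ _ ⟩
  2 * a′ + bit b′   ∎
  where open ≤-Reasoning

parity : ∀ m → ∃[ j ] (m ≡ j + j ⊎ m ≡ suc (j + j))
parity zero    = 0 , inj₁ refl
parity (suc m) with parity m
... | j , inj₁ m≡j+j   = j , inj₂ (cong suc m≡j+j)
... | j , inj₂ m≡1+j+j = suc j , inj₁ (trans (cong suc m≡1+j+j) (cong suc (sym (+-suc j j))))

Unique-lookup-injective : ∀ {A : Set} {xs : List A} → Unique xs → ∀ i j → lookup xs i ≡ lookup xs j → i ≡ j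
Unique-lookup-injective (x∉xs ∷ u) Fin.zero    Fin.zero    eq = refl
Unique-lookup-injective (x∉xs ∷ u) Fin.zero    (Fin.suc j) eq = contradiction eq (All.lookup x∉xs (∈-lookup j))
Unique-lookup-injective (x∉xs ∷ u) (Fin.suc i) Fin.zero    eq = contradiction (sym eq) (All.lookup x∉xs (∈-lookup i))
Unique-lookup-injective (x∉xs ∷ u) (Fin.suc i) (Fin.suc j) eq = cong Fin.suc (Unique-lookup-injective u i j eq)

Unique⇒length≤ : ∀ {A : Set} {m} {xs : List A} (f : A → Fin m) → (∀ {x y} → f x ≡ f y → x ≡ y) →
  Unique xs → length xs ≤ m
Unique⇒length≤ f f-inj u = injective⇒≤ (λ {i} {j} eq → Unique-lookup-injective u i j (f-inj eq))

concatMap-unique : ∀ {A B : Set} {f : A → List B} {xs : List A} →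
  All (Unique ∘ f) xs → AllPairs (λ x y → Disjoint (f x) (f y)) xs → Unique (concatMap f xs)
concatMap-unique u d = Unique.concat⁺ (All.map⁺ u) (AllPairs.map⁺ d)

∈⇒0<length : ∀ {A : Set} {x : A} {xs} → x ∈ xs → 0 < length xs
∈⇒0<length (here _)  = s≤s z≤n
∈⇒0<length (there _) = s≤s z≤n

filter-nonempty : ∀ {A : Set} {P : A → Set} (P? : ∀ x → Dec (P x)) xs → length (filter P? xs) ≢ 0 → ∃ P
filter-nonempty P? xs = go (filter P? xs) (all-filter P? xs)
  where
  go : ∀ ys → All _ ys → length ys ≢ 0 → ∃ _
  go []       _        len≢0 = contradiction refl len≢0
  go (y ∷ _) (Py ∷ _) _     = y , Py

length-filter-∷ : ∀ {A : Set} (Q : A → Bool) x xs →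
  length (filter (T? ∘ Q) (x ∷ xs)) ≡ bit (Q x) + length (filter (T? ∘ Q) xs)
length-filter-∷ Q x xs = go (Q x) refl
  where
  go : ∀ b → Q x ≡ b → length (filter (T? ∘ Q) (x ∷ xs)) ≡ bit b + length (filter (T? ∘ Q) xs)
  go true  Qx = cong length (filter-accept (T? ∘ Q) (subst T (sym Qx) _))
  go false Qx = cong length (filter-reject (T? ∘ Q) (subst T Qx))

iterate-+ : ∀ {A : Set} (f : A → A) a b x → iterate f (a + b) x ≡ iterate f a (iterate f b x)
iterate-+ f zero    b x = refl
iterate-+ f (suc a) b x = cong f (iterate-+ f a b x)

iterate-suc : ∀ {A : Set} (f : A → A) k x → iterate f k (f x) ≡ f (iterate f k x)
iterate-suc f zero    x = refl
iterate-suc f (suc k) x = cong f (iterate-suc f k x)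

iterate-injective : ∀ {A : Set} {f : A → A} → (∀ {x y} → f x ≡ f y → x ≡ y) →
  ∀ k {x y} → iterate f k x ≡ iterate f k y → x ≡ y
iterate-injective f-inj zero    eq = eq
iterate-injective f-inj (suc k) eq = iterate-injective f-inj k (f-inj eq)

iterate-periodic : ∀ {A : Set} (f : A → A) {p x} → iterate f p x ≡ x → ∀ q → iterate f (q * p) x ≡ x
iterate-periodic f       fᵖx≡x zero    = refl
iterate-periodic f {p} {x} fᵖx≡x (suc q) =
  trans (iterate-+ f p (q * p) x) (trans (cong (iterate f p) (iterate-periodic f fᵖx≡x q)) fᵖx≡x)

sumBelow : ℕ → (ℕ → ℕ) → ℕ
sumBelow zero    f = 0
sumBelow (suc m) f = f 0 + sumBelow m (f ∘ suc)

sumBelow-+ : ∀ m f g → sumBelow m (λ t → f t + g t) ≡ sumBelow m f + sumBelow m g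
sumBelow-+ zero    f g = refl
sumBelow-+ (suc m) f g = trans (cong (f 0 + g 0 +_) (sumBelow-+ m (f ∘ suc) (g ∘ suc)))
                               (+-assoc-comm (f 0) (g 0) (sumBelow m (f ∘ suc)) (sumBelow m (g ∘ suc)))
  where
  +-assoc-comm : ∀ a b c d → a + b + (c + d) ≡ a + c + (b + d)
  +-assoc-comm = solve 4 (λ a b c d → a :+ b :+ (c :+ d) := a :+ c :+ (b :+ d)) refl

sumBelow-split : ∀ a b f → sumBelow (a + b) f ≡ sumBelow a f + sumBelow b (λ t → f (a + t))
sumBelow-split zero    b f = refl
sumBelow-split (suc a) b f = trans (cong (f 0 +_) (sumBelow-split a b (f ∘ suc))) (sym (+-assoc (f 0) _ _))

sumBelow-const : ∀ m {f c} → (∀ t → t < m → f t ≡ c) → sumBelow m f ≡ m * c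
sumBelow-const zero    f≡c = refl
sumBelow-const (suc m) f≡c = cong₂ _+_ (f≡c 0 (s≤s z≤n)) (sumBelow-const m (λ t t<m → f≡c (suc t) (s≤s t<m)))

sumBelow-interval : ∀ {a b} m → a ≤ b → b ≤ m → sumBelow m (λ t → bit ((a ≤ᵇ t) ∧ (t <ᵇ b))) ≡ b ∸ a
sumBelow-interval {a} {b} m a≤b b≤m = begin
  sumBelow m f
    ≡⟨ cong (λ m → sumBelow m f) (sym m≡) ⟩
  sumBelow (a + ((b ∸ a) + (m ∸ b))) f
    ≡⟨ sumBelow-split a _ f ⟩
  sumBelow a f + sumBelow ((b ∸ a) + (m ∸ b)) (λ t → f (a + t))
    ≡⟨ cong (sumBelow a f +_) (sumBelow-split (b ∸ a) (m ∸ b) _) ⟩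
  sumBelow a f + (sumBelow (b ∸ a) (λ t → f (a + t)) + sumBelow (m ∸ b) (λ t → f (a + ((b ∸ a) + t))))
    ≡⟨ cong₂ (λ x y → x + (y + sumBelow (m ∸ b) (λ t → f (a + ((b ∸ a) + t)))))
             (sumBelow-const a below) (sumBelow-const (b ∸ a) inside) ⟩
  a * 0 + ((b ∸ a) * 1 + sumBelow (m ∸ b) (λ t → f (a + ((b ∸ a) + t))))
    ≡⟨ cong (λ x → a * 0 + ((b ∸ a) * 1 + x)) (sumBelow-const (m ∸ b) above) ⟩
  a * 0 + ((b ∸ a) * 1 + (m ∸ b) * 0)
    ≡⟨ solve 3 (λ a d e → a :* con 0 :+ (d :* con 1 :+ e :* con 0) := d) refl a (b ∸ a) (m ∸ b) ⟩
  b ∸ a ∎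
  where
  open ≡-Reasoning
  f : ℕ → ℕ
  f t = bit ((a ≤ᵇ t) ∧ (t <ᵇ b))
  m≡ : a + ((b ∸ a) + (m ∸ b)) ≡ m
  m≡ = trans (sym (+-assoc a _ _)) (trans (cong (_+ (m ∸ b)) (m+[n∸m]≡n a≤b)) (m+[n∸m]≡n b≤m))
  below : ∀ t → t < a → f t ≡ 0
  below t t<a = cong (λ x → bit (x ∧ _)) (≤ᵇ-false t<a)
  inside : ∀ t → t < b ∸ a → f (a + t) ≡ 1
  inside t t<b-a = cong₂ (λ x y → bit (x ∧ y)) (≤ᵇ-true (m≤m+n a t))
    (<ᵇ-true (subst (a + t <_) (m+[n∸m]≡n a≤b) (+-monoʳ-< a t<b-a)))
  above : ∀ t → t < m ∸ b → f (a + ((b ∸ a) + t)) ≡ 0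
  above t _ = cong bit (trans (cong ((a ≤ᵇ a + ((b ∸ a) + t)) ∧_)
    (<ᵇ-false (subst (b ≤_) (sym (trans (sym (+-assoc a _ t)) (cong (_+ t) (m+[n∸m]≡n a≤b)))) (m≤m+n b t))))
    (∧-zeroʳ _))

sum-tabulate-toℕ : ∀ m (w : ℕ → ℕ) → sum (List.tabulate {n = m} (w ∘ toℕ)) ≡ sumBelow m w
sum-tabulate-toℕ zero    w = refl
sum-tabulate-toℕ (suc m) w = cong (w 0 +_) (sum-tabulate-toℕ m (w ∘ suc))

toℕ-nextF-< : ∀ {m} (p : Fin (suc m)) → toℕ p < m → toℕ (nextF p) ≡ suc (toℕ p)
toℕ-nextF-< p p<m = trans (toℕ-fromℕ< _) (m<n⇒m%n≡m (s≤s p<m))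

toℕ-nextF-last : ∀ {m} (p : Fin (suc m)) → toℕ p ≡ m → toℕ (nextF p) ≡ 0
toℕ-nextF-last {m} p p≡m =
  trans (toℕ-fromℕ< _) (trans (cong (λ x → suc x % suc m) p≡m) (n%n≡0 (suc m)))

toℕ-prevF-suc : ∀ {m j} (p : Fin (suc m)) → toℕ p ≡ suc j → toℕ (prevF p) ≡ j
toℕ-prevF-suc {m} {j} p p≡1+j = begin
  toℕ (prevF p)       ≡⟨ toℕ-fromℕ< _ ⟩
  (toℕ p + m) % suc m ≡⟨ cong (λ x → (x + m) % suc m) p≡1+j ⟩
  (suc j + m) % suc m ≡⟨ cong (_% suc m) (sym (+-suc j m)) ⟩
  (j + suc m) % suc m ≡⟨ [m+n]%n≡m%n j (suc m) ⟩
  j % suc m           ≡⟨ m<n⇒m%n≡m j<1+m ⟩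
  j                   ∎
  where
  open ≡-Reasoning
  j<1+m : j < suc m
  j<1+m = <-trans (n<1+n j) (subst (_< suc m) p≡1+j (toℕ<n p))

toℕ-prevF-zero : ∀ {m} (p : Fin (suc m)) → toℕ p ≡ 0 → toℕ (prevF p) ≡ m
toℕ-prevF-zero {m} p p≡0 =
  trans (toℕ-fromℕ< _) (trans (cong (λ x → (x + m) % suc m) p≡0) (m<n⇒m%n≡m (n<1+n m)))

nextF-cases : ∀ {m} (p : Fin (suc m)) →
  (toℕ p < m × toℕ (nextF p) ≡ suc (toℕ p)) ⊎ (toℕ p ≡ m × toℕ (nextF p) ≡ 0)
nextF-cases {m} p with toℕ p <? m
... | yes p<m = inj₁ (p<m , toℕ-nextF-< p p<m)
... | no p≮m  = inj₂ (p≡m , toℕ-nextF-last p p≡m)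
  where p≡m = ≤-antisym (≤-pred (toℕ<n p)) (≮⇒≥ p≮m)

prevF-nextF : ∀ {m} (p : Fin m) → prevF (nextF p) ≡ p
prevF-nextF {suc m} p with nextF-cases p
... | inj₁ (_ , next≡1+p) = toℕ-injective (toℕ-prevF-suc (nextF p) next≡1+p)
... | inj₂ (p≡m , next≡0) = toℕ-injective (trans (toℕ-prevF-zero (nextF p) next≡0) (sym p≡m))

nextF-prevF : ∀ {m} (p : Fin m) → nextF (prevF p) ≡ p
nextF-prevF {suc m} p = go (toℕ p) refl
  where
  go : ∀ t → toℕ p ≡ t → nextF (prevF p) ≡ p
  go zero    p≡0   = toℕ-injective (trans (toℕ-nextF-last (prevF p) (toℕ-prevF-zero p p≡0)) (sym p≡0))
  go (suc t) p≡1+t = toℕ-injective (trans (toℕ-nextF-< (prevF p) prev<m) (trans (cong suc prev≡t) (sym p≡1+t)))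
    where
    prev≡t = toℕ-prevF-suc p p≡1+t
    prev<m : toℕ (prevF p) < m
    prev<m = subst (_< m) (sym prev≡t) (≤-pred (subst (_< suc m) p≡1+t (toℕ<n p)))

nextF-induction : ∀ {m} (P : Fin (suc m) → Set) →
  P Fin.zero → (∀ p → P p → P (nextF p)) → ∀ p → P p
nextF-induction P P0 P-next p = go (toℕ p) p refl
  where
  go : ∀ t p → toℕ p ≡ t → P p
  go zero    p p≡0   = subst P (toℕ-injective (sym p≡0)) P0
  go (suc t) p p≡1+t = subst P (nextF-prevF p) (P-next (prevF p) (go t (prevF p) (toℕ-prevF-suc p p≡1+t)))

strictlyBetween-true : ∀ {x a b} → a < x → x < b → strictlyBetween x a b ≡ true
strictlyBetween-true a<x x<b rewrite <ᵇ-true a<x | <ᵇ-true x<b = refl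

strictlyBetween-false : ∀ {x a b} → a ≤ b → x ≤ a ⊎ b ≤ x → strictlyBetween x a b ≡ false
strictlyBetween-false {x} {a} {b} a≤b (inj₁ x≤a) rewrite <ᵇ-false x≤a | <ᵇ-false (≤-trans x≤a a≤b) = refl
strictlyBetween-false {x} {a} {b} a≤b (inj₂ b≤x)
  rewrite <ᵇ-false b≤x | <ᵇ-false (≤-trans a≤b b≤x) | ∧-zeroʳ (a <ᵇ x) | ∧-zeroʳ (b <ᵇ x) = refl

strictlyBetween-sym : ∀ x a b → strictlyBetween x a b ≡ strictlyBetween x b a
strictlyBetween-sym x a b = ∨-comm ((a <ᵇ x) ∧ (x <ᵇ b)) ((b <ᵇ x) ∧ (x <ᵇ a))

strictlyBetween⇒ : ∀ {x a b} → a < b → strictlyBetween x a b ≡ true → a < x × x < b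
strictlyBetween⇒ {x} {a} {b} a<b between with a <? x | x <? b
... | yes a<x | yes x<b = a<x , x<b
... | no a≮x  | _       = contradiction (trans (sym between) (strictlyBetween-false (<⇒≤ a<b) (inj₁ (≮⇒≥ a≮x)))) λ ()
... | yes _   | no x≮b  = contradiction (trans (sym between) (strictlyBetween-false (<⇒≤ a<b) (inj₂ (≮⇒≥ x≮b)))) λ ()

adjacent-strictlyBetween-constant : ∀ {m} (q : Fin m) → ∃[ b ] ∀ x → x ≢ q → x ≢ nextF q →
  strictlyBetween (toℕ x) (toℕ q) (toℕ (nextF q)) ≡ b
adjacent-strictlyBetween-constant {suc m} q with nextF-cases q
... | inj₁ (_ , next≡1+q) = false , λ x x≢q x≢next → strictlyBetween-false
  (subst (toℕ q ≤_) (sym next≡1+q) (n≤1+n _)) (outside x x≢q x≢next)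
  where
  outside : ∀ x → x ≢ q → x ≢ nextF q → toℕ x ≤ toℕ q ⊎ toℕ (nextF q) ≤ toℕ x
  outside x x≢q x≢next with <-cmp (toℕ x) (toℕ q)
  ... | tri< x<q _ _ = inj₁ (<⇒≤ x<q)
  ... | tri≈ _ x≡q _ = contradiction (toℕ-injective x≡q) x≢q
  ... | tri> _ _ q<x = inj₂ (subst (_≤ toℕ x) (sym next≡1+q) q<x)
... | inj₂ (q≡m , next≡0) = true , λ x x≢q x≢next →
  trans (strictlyBetween-sym (toℕ x) (toℕ q) (toℕ (nextF q))) (strictlyBetween-true (next<x x x≢next) (x<q x x≢q))
  where
  next<x : ∀ x → x ≢ nextF q → toℕ (nextF q) < toℕ x
  next<x x x≢next rewrite next≡0 = n≢0⇒n>0 (λ x≡0 → x≢next (toℕ-injective (trans x≡0 (sym next≡0))))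
  x<q : ∀ x → x ≢ q → toℕ x < toℕ q
  x<q x x≢q = ≤∧≢⇒< (subst (toℕ x ≤_) (sym q≡m) (≤-pred (toℕ<n x))) (x≢q ∘ toℕ-injective)

diameters-cross : ∀ {n a v} → a < n → v < n → a ≢ v →
  strictlyBetween v a (a + n) xor strictlyBetween (v + n) a (a + n) ≡ true
diameters-cross {n} {a} {v} a<n v<n a≢v with <-cmp a v
... | tri< a<v _ _ rewrite strictlyBetween-true a<v (<-≤-trans v<n (m≤n+m n a))
                         | strictlyBetween-false {v + n} (m≤m+n a n) (inj₂ (+-monoˡ-≤ n (<⇒≤ a<v))) = refl
... | tri≈ _ a≡v _ = contradiction a≡v a≢v
... | tri> _ _ v<a rewrite strictlyBetween-false {v} (m≤m+n a n) (inj₁ (<⇒≤ v<a))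
                         | strictlyBetween-true (<-≤-trans a<n (m≤n+m n v)) (+-monoˡ-< n v<a) = refl

position : ∀ {n} → Corner n → Fin (n + n)
position (corner p _) = p

side : ∀ {n} → Corner n → Bool
side (corner _ s) = s

arcMove-involutive : ∀ {n} (c : Corner n) → arcMove (arcMove c) ≡ c
arcMove-involutive (corner p true)  = cong (λ q → corner q true) (prevF-nextF p)
arcMove-involutive (corner p false) = cong (λ q → corner q false) (nextF-prevF p)

arcMove-injective : ∀ {n} {c d : Corner n} → arcMove c ≡ arcMove d → c ≡ d
arcMove-injective {c = c} {d} eq =
  trans (sym (arcMove-involutive c)) (trans (cong arcMove eq) (arcMove-involutive d))

arcMove-fixpointFree : ∀ {n} (c : Corner n) → arcMove c ≢ c
arcMove-fixpointFree (corner p true)  ()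
arcMove-fixpointFree (corner p false) ()

cornerKey-injective : ∀ {n} {c d : Corner n} → cornerKey c ≡ cornerKey d → c ≡ d
cornerKey-injective {c = corner p s} {corner q t} eq with s | t
... | false | false = cong (λ r → corner r false) (toℕ-injective (*-cancelˡ-≡ _ _ 2 (+-cancelʳ-≡ 0 _ _ eq)))
... | true  | true  = cong (λ r → corner r true) (toℕ-injective (*-cancelˡ-≡ _ _ 2 (+-cancelʳ-≡ 1 _ _ eq)))
... | false | true  = contradiction (trans (sym (+-identityʳ _)) (trans eq (+-comm _ 1)))       (even≢odd (toℕ p) (toℕ q))
... | true  | false = contradiction (trans (sym (+-identityʳ _)) (trans (sym eq) (+-comm _ 1))) (even≢odd (toℕ q) (toℕ p))

cornerKey-<-position : ∀ {n} {p q : Fin (n + n)} b b′ → toℕ p < toℕ q →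
  cornerKey {n} (corner p b) < cornerKey {n} (corner q b′)
cornerKey-<-position b b′ = doubled-< b b′

cornerKey<4n : ∀ {n} (c : Corner n) → cornerKey c < 4 * n
cornerKey<4n {n} (corner p s) = begin-strict
  2 * toℕ p + bit s       <⟨ doubled-< s false (toℕ<n p) ⟩
  2 * (n + n) + 0         ≡⟨ solve 1 (λ n → con 2 :* (n :+ n) :+ con 0 := con 4 :* n) refl n ⟩
  4 * n                   ∎
  where open ≤-Reasoning

cornerIndex : ∀ {n} → Corner n → Fin (4 * n)
cornerIndex c = fromℕ< (cornerKey<4n c)

cornerIndex-injective : ∀ {n} {c d : Corner n} → cornerIndex c ≡ cornerIndex d → c ≡ d
cornerIndex-injective eq =
  cornerKey-injective (trans (sym (toℕ-fromℕ< _)) (trans (cong toℕ eq) (toℕ-fromℕ< _)))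

_≟ᶜ_ : ∀ {n} (c d : Corner n) → Dec (c ≡ d)
c ≟ᶜ d = map′ cornerKey-injective (cong cornerKey) (cornerKey c ≟ cornerKey d)

block : ∀ {n} → Fin (n + n) → List (Corner n)
block p = corner p false ∷ corner p true ∷ []

allCorners-unique : ∀ n → Unique (allCorners n)
allCorners-unique n = concatMap-unique (All.universal (λ p → ((λ ()) ∷ []) ∷ [] ∷ []) _)
                                       (AllPairs.map blocks-disjoint (Unique.allFin⁺ (n + n)))
  where
  block-position : ∀ {p} {c : Corner n} → c ∈ block p → position c ≡ p
  block-position (here refl)         = refl
  block-position (there (here refl)) = refl
  blocks-disjoint : ∀ {p q} → p ≢ q → Disjoint (block p) (block q)
  blocks-disjoint p≢q (c∈p , c∈q) = p≢q (trans (sym (block-position c∈p)) (block-position c∈q))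

count-allCorners : ∀ {n} (Q : Corner n → Bool) (q : Bool → ℕ → Bool) → (∀ x b → Q (corner x b) ≡ q b (toℕ x)) →
  length (filter (T? ∘ Q) (allCorners n)) ≡ sumBelow (n + n) (λ t → bit (q false t) + bit (q true t))
count-allCorners {n} Q q Q≡q = begin
  length (filter (T? ∘ Q) (allCorners n))        ≡⟨ count-blocks (allFin (n + n)) ⟩
  sum (map (w ∘ toℕ) (allFin (n + n)))           ≡⟨ cong sum (map-tabulate {n = n + n} id (w ∘ toℕ)) ⟩
  sum (List.tabulate {n = n + n} (w ∘ toℕ)) ≡⟨ sum-tabulate-toℕ (n + n) w ⟩
  sumBelow (n + n) w                             ∎
  where
  open ≡-Reasoning
  w : ℕ → ℕ
  w t = bit (q false t) + bit (q true t)
  count-blocks : ∀ xs → length (filter (T? ∘ Q) (concatMap block xs)) ≡ sum (map (w ∘ toℕ) xs)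
  count-blocks []       = refl
  count-blocks (x ∷ xs) = begin
    length (filter (T? ∘ Q) (corner x false ∷ corner x true ∷ rest))
      ≡⟨ length-filter-∷ Q (corner x false) _ ⟩
    bit (Q (corner x false)) + length (filter (T? ∘ Q) (corner x true ∷ rest))
      ≡⟨ cong (bit (Q (corner x false)) +_) (length-filter-∷ Q (corner x true) _) ⟩
    bit (Q (corner x false)) + (bit (Q (corner x true)) + length (filter (T? ∘ Q) rest))
      ≡⟨ sym (+-assoc (bit (Q (corner x false))) _ _) ⟩
    bit (Q (corner x false)) + bit (Q (corner x true)) + length (filter (T? ∘ Q) rest)
      ≡⟨ cong₂ _+_ (cong₂ (λ a b → bit a + bit b) (Q≡q x false) (Q≡q x true)) (count-blocks xs) ⟩
    w (toℕ x) + sum (map (w ∘ toℕ) xs) ∎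
    where rest = concatMap block xs

module Chords {n : ℕ} (B : Bouquet n) where

  chord : Fin (n + n) → Fin n
  chord p = proj₁ (word B p)

  partner : Fin (n + n) → Fin (n + n)
  partner p = pos B (chord p , not (proj₂ (word B p)))

  twistedAt : Fin (n + n) → Bool
  twistedAt p = twisted B (chord p)

  word-partner : ∀ p → word B (partner p) ≡ (chord p , not (proj₂ (word B p)))
  word-partner p = word-pos B _

  chord-partner : ∀ p → chord (partner p) ≡ chord p
  chord-partner p = cong proj₁ (word-partner p)

  twistedAt-partner : ∀ p → twistedAt (partner p) ≡ twistedAt p
  twistedAt-partner p = cong (twisted B) (chord-partner p)

  partner-involutive : ∀ p → partner (partner p) ≡ p
  partner-involutive p
    rewrite word-partner p | not-involutive (proj₂ (word B p)) = pos-word B p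

  partner-swap : ∀ {p q} → partner p ≡ q → partner q ≡ p
  partner-swap {p} refl = partner-involutive p

  partner-fixpointFree : ∀ p → partner p ≢ p
  partner-fixpointFree p eq = not-fixpointFree (cong proj₂ (trans (sym (word-partner p)) (cong (word B) eq)))
    where
    not-fixpointFree : ∀ {b} → not b ≢ b
    not-fixpointFree {true}  ()
    not-fixpointFree {false} ()

  NoShortChord : Set
  NoShortChord = ∀ p → partner (nextF p) ≢ p

  same-chord : ∀ p q → chord q ≡ chord p → q ≡ p ⊎ q ≡ partner p
  same-chord p q eq with ≡-or-≡not (proj₂ (word B p)) (proj₂ (word B q))
  ... | inj₁ same = inj₁ (trans (sym (pos-word B q)) (trans (cong (pos B) (cong₂ _,_ eq same)) (pos-word B p)))
  ... | inj₂ opp  = inj₂ (trans (sym (pos-word B q)) (cong (pos B) (cong₂ _,_ eq opp)))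

  ChordEnds : Fin (n + n) → Set
  ChordEnds p = (pos B (chord p , false) ≡ p × pos B (chord p , true) ≡ partner p)
              ⊎ (pos B (chord p , false) ≡ partner p × pos B (chord p , true) ≡ p)

  chord-ends : ∀ p → ChordEnds p
  chord-ends p = go (proj₂ (word B p)) refl
    where
    go : ∀ b → proj₂ (word B p) ≡ b → ChordEnds p
    go false eq = inj₁ (trans (cong (λ b → pos B (chord p , b)) (sym eq)) (pos-word B p) ,
                        cong (λ b → pos B (chord p , not b)) (sym eq))
    go true  eq = inj₂ (cong (λ b → pos B (chord p , not b)) (sym eq) ,
                        trans (cong (λ b → pos B (chord p , b)) (sym eq)) (pos-word B p))

  interlaced-at : ∀ p j → interlaced B (chord p) j ≡
    strictlyBetween (toℕ (pos B (j , false))) (toℕ p) (toℕ (partner p)) xor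
    strictlyBetween (toℕ (pos B (j , true)))  (toℕ p) (toℕ (partner p))
  interlaced-at p j with chord-ends p
  ... | inj₁ (e₀ , e₁) rewrite e₀ | e₁ = refl
  ... | inj₂ (e₀ , e₁) rewrite e₀ | e₁
    | strictlyBetween-sym (toℕ (pos B (j , false))) (toℕ (partner p)) (toℕ p)
    | strictlyBetween-sym (toℕ (pos B (j , true)))  (toℕ (partner p)) (toℕ p) = refl

  interlaced-chords : ∀ p q → interlaced B (chord p) (chord q) ≡
    strictlyBetween (toℕ q) (toℕ p) (toℕ (partner p)) xor strictlyBetween (toℕ (partner q)) (toℕ p) (toℕ (partner p))
  interlaced-chords p q with chord-ends q
  ... | inj₁ (e₀ , e₁) rewrite interlaced-at p (chord q) | e₀ | e₁ = refl
  ... | inj₂ (e₀ , e₁) rewrite interlaced-at p (chord q) | e₀ | e₁ =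
    xor-comm (strictlyBetween (toℕ (partner q)) (toℕ p) (toℕ (partner p))) _

  pos-other-chord : ∀ {p j} b → j ≢ chord p → pos B (j , b) ≢ p
  pos-other-chord {p} {j} b j≢i eq = j≢i (cong proj₁ (trans (sym (word-pos B (j , b))) (cong (word B) eq)))

  chord-shortChord : ∀ {q} → partner (nextF q) ≡ q → chord (nextF q) ≡ chord q
  chord-shortChord {q} short = trans (cong chord (sym (partner-swap short))) (chord-partner q)

  shortChord-isolated : ∀ {q} → partner (nextF q) ≡ q → ∀ j → j ≢ chord q → interlaced B (chord q) j ≡ false
  shortChord-isolated {q} short j j≢i with adjacent-strictlyBetween-constant q
  ... | b , constant = begin
    interlaced B (chord q) j                                ≡⟨ interlaced-at q j ⟩
    between (pos B (j , false)) xor between (pos B (j , true)) ≡⟨ cong₂ _xor_ (outside false) (outside true) ⟩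
    b xor b                                                 ≡⟨ xor-same b ⟩
    false                                                   ∎
    where
    open ≡-Reasoning
    between : Fin (n + n) → Bool
    between x = strictlyBetween (toℕ x) (toℕ q) (toℕ (partner q))
    outside : ∀ e → between (pos B (j , e)) ≡ b
    outside e rewrite partner-swap short =
      constant (pos B (j , e)) (pos-other-chord e j≢i)
                              (pos-other-chord e (j≢i ∘ λ eq → trans eq (chord-shortChord short)))

  edgeMove-corner : ∀ p s → edgeMove B (corner p s) ≡ corner (partner p) (if twistedAt p then s else not s)
  edgeMove-corner p s with word B p
  ... | (i , b) = refl

  edgeMove-involutive : ∀ c → edgeMove B (edgeMove B c) ≡ c
  edgeMove-involutive (corner p s)
    rewrite edgeMove-corner p s | edgeMove-corner (partner p) (if twistedAt p then s else not s)
          | partner-involutive p | twistedAt-partner p with twistedAt p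
  ... | true  = refl
  ... | false = cong (corner p) (not-involutive s)

  edgeMove-injective : ∀ {c d} → edgeMove B c ≡ edgeMove B d → c ≡ d
  edgeMove-injective {c} {d} eq =
    trans (sym (edgeMove-involutive c)) (trans (cong (edgeMove B) eq) (edgeMove-involutive d))

  edgeMove-fixpointFree : ∀ c → edgeMove B c ≢ c
  edgeMove-fixpointFree (corner p s) eq =
    partner-fixpointFree p (cong position (trans (sym (edgeMove-corner p s)) eq))

  traverse-injective : ∀ {c d} → traverse B c ≡ traverse B d → c ≡ d
  traverse-injective = arcMove-injective ∘ edgeMove-injective

  traverse-arcMove : ∀ c → traverse B (arcMove c) ≡ edgeMove B c
  traverse-arcMove c = cong (edgeMove B) (arcMove-involutive c)

  traverse-right : ∀ p → traverse B (corner p true) ≡ corner (partner (nextF p)) (not (twistedAt (nextF p)))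
  traverse-right p = trans (edgeMove-corner (nextF p) false) (cong (corner _) (if-false (twistedAt (nextF p))))
    where
    if-false : ∀ b → (if b then false else true) ≡ not b
    if-false true  = refl
    if-false false = refl

  traverse-left : ∀ p → traverse B (corner p false) ≡ corner (partner (prevF p)) (twistedAt (prevF p))
  traverse-left p = trans (edgeMove-corner (prevF p) true) (cong (corner _) (if-true (twistedAt (prevF p))))
    where
    if-true : ∀ b → (if b then true else false) ≡ b
    if-true true  = refl
    if-true false = refl

-- Boundary components

module Faces {n : ℕ} (B : Bouquet n) where

  open Chords B

  traverse-period : ∀ c → ∃[ p ] 0 < p × p ≤ 4 * n × iterate (traverse B) p c ≡ c
  traverse-period c with pigeonhole (n<1+n (4 * n)) (λ i → cornerIndex (iterate (traverse B) (toℕ i) c))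
  ... | i , j , i<j , eq = toℕ j ∸ toℕ i , m<n⇒0<n∸m i<j , ≤-trans (m∸n≤m (toℕ j) (toℕ i)) (≤-pred (toℕ<n j)) ,
                           sym (iterate-injective traverse-injective (toℕ i) Tⁱc≡Tⁱ[Tʲ⁻ⁱc])
    where
    open ≡-Reasoning
    walk = traverse B
    Tⁱc≡Tⁱ[Tʲ⁻ⁱc] : iterate walk (toℕ i) c ≡ iterate walk (toℕ i) (iterate walk (toℕ j ∸ toℕ i) c)
    Tⁱc≡Tⁱ[Tʲ⁻ⁱc] = begin
      iterate walk (toℕ i) c                            ≡⟨ cornerIndex-injective eq ⟩
      iterate walk (toℕ j) c                            ≡⟨ cong (λ k → iterate walk k c) (sym (m+[n∸m]≡n (<⇒≤ i<j))) ⟩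
      iterate walk (toℕ i + (toℕ j ∸ toℕ i)) c          ≡⟨ iterate-+ walk (toℕ i) _ c ⟩
      iterate walk (toℕ i) (iterate walk (toℕ j ∸ toℕ i) c) ∎

  iterate-below-4n : ∀ c k → ∃[ k′ ] k′ < 4 * n × iterate (traverse B) k c ≡ iterate (traverse B) k′ c
  iterate-below-4n c k with traverse-period c
  ... | suc p , _ , p≤4n , period = k % suc p , <-≤-trans (m%n<n k (suc p)) p≤4n , (begin
    iterate walk k c                                       ≡⟨ cong (λ m → iterate walk m c) (m≡m%n+[m/n]*n k (suc p)) ⟩
    iterate walk (k % suc p + k / suc p * suc p) c         ≡⟨ iterate-+ walk (k % suc p) _ c ⟩
    iterate walk (k % suc p) (iterate walk (k / suc p * suc p) c)
      ≡⟨ cong (iterate walk (k % suc p)) (iterate-periodic walk period (k / suc p)) ⟩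
    iterate walk (k % suc p) c                             ∎)
    where
    open ≡-Reasoning
    walk = traverse B

  SameFace : Corner n → Corner n → Set
  SameFace c d = ∃[ k ] (d ≡ iterate (traverse B) k c ⊎ d ≡ arcMove (iterate (traverse B) k c))

  sameFace-refl : ∀ c → SameFace c c
  sameFace-refl c = 0 , inj₁ refl

  sameFace-arcMove : ∀ {c d} → SameFace c d → SameFace c (arcMove d)
  sameFace-arcMove (k , inj₁ refl) = k , inj₂ refl
  sameFace-arcMove (k , inj₂ refl) = k , inj₁ (arcMove-involutive _)

  sameFace-traverse : ∀ {c d} → SameFace c d → SameFace c (traverse B d)
  sameFace-traverse (k , inj₁ refl)     = suc k , inj₁ refl
  sameFace-traverse (suc k , inj₂ refl) = k , inj₂ (trans (traverse-arcMove _) (edgeMove-involutive _))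
  sameFace-traverse {c} (zero , inj₂ refl) with traverse-period c
  ... | suc p , _ , _ , period =
    p , inj₂ (trans (traverse-arcMove c) (trans (cong (edgeMove B) (sym period)) (edgeMove-involutive _)))

  sameFace-iterate : ∀ {c d} k → SameFace c d → SameFace c (iterate (traverse B) k d)
  sameFace-iterate zero    c~d = c~d
  sameFace-iterate (suc k) c~d = sameFace-traverse (sameFace-iterate k c~d)

  sameFace-trans : ∀ {c d e} → SameFace c d → SameFace d e → SameFace c e
  sameFace-trans c~d (k , inj₁ refl) = sameFace-iterate k c~d
  sameFace-trans c~d (k , inj₂ refl) = sameFace-arcMove (sameFace-iterate k c~d)

  sameFace-traverse⁻¹ : ∀ c → SameFace (traverse B c) c
  sameFace-traverse⁻¹ c with traverse-period (traverse B c)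
  ... | suc p , _ , _ , period = p , inj₁ (sym (traverse-injective period))

  sameFace-sym : ∀ {c d} → SameFace c d → SameFace d c
  sameFace-sym {c} (k , inj₁ refl) = back k c
    where
    back : ∀ k c → SameFace (iterate (traverse B) k c) c
    back zero    c = sameFace-refl c
    back (suc k) c = sameFace-trans (sameFace-traverse⁻¹ (iterate (traverse B) k c)) (back k c)
  sameFace-sym {c} (k , inj₂ refl) =
    sameFace-trans (0 , inj₂ refl)
                   (subst (λ d → SameFace d c) (sym (arcMove-involutive _)) (sameFace-sym (k , inj₁ refl)))

  KeyMinimalAt : Corner n → ℕ → Set
  KeyMinimalAt c k =
    cornerKey c ≤ cornerKey (iterate (traverse B) k c) × cornerKey c ≤ cornerKey (arcMove (iterate (traverse B) k c))

  isComponentMin⇒ : ∀ {c k} → T (isComponentMin B c) → k < 4 * n → KeyMinimalAt c k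
  isComponentMin⇒ {c} min k<4n with Equivalence.to T-∧ (All.lookup (all⁺ _ (upTo (4 * n)) min) (∈-upTo⁺ k<4n))
  ... | ≤ᵇ₁ , ≤ᵇ₂ = ≤ᵇ⇒≤ _ _ ≤ᵇ₁ , ≤ᵇ⇒≤ _ _ ≤ᵇ₂

  isComponentMin⇐ : ∀ {c} → (∀ k → KeyMinimalAt c k) → T (isComponentMin B c)
  isComponentMin⇐ keys = all⁻ _ {upTo (4 * n)} (All.tabulate (λ {k} _ →
    Equivalence.from T-∧ (≤⇒≤ᵇ (proj₁ (keys k)) , ≤⇒≤ᵇ (proj₂ (keys k)))))

  componentMin-minimal : ∀ {c d} → T (isComponentMin B c) → SameFace c d → cornerKey c ≤ cornerKey d
  componentMin-minimal {c} min (k , d≡) with iterate-below-4n c k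
  ... | k′ , k′<4n , eq with isComponentMin⇒ min k′<4n | d≡
  ... | ≤₁ , ≤₂ | inj₁ refl = subst (λ e → cornerKey c ≤ cornerKey e) (sym eq) ≤₁
  ... | ≤₁ , ≤₂ | inj₂ refl = subst (λ e → cornerKey c ≤ cornerKey (arcMove e)) (sym eq) ≤₂

  componentMin-unique : ∀ {c c′ d} → T (isComponentMin B c) → T (isComponentMin B c′) →
    SameFace c d → SameFace c′ d → c ≡ c′
  componentMin-unique min min′ c~d c′~d = cornerKey-injective (≤-antisym
    (componentMin-minimal min  (sameFace-trans c~d  (sameFace-sym c′~d)))
    (componentMin-minimal min′ (sameFace-trans c′~d (sameFace-sym c~d))))

  open import Data.List.Membership.DecPropositional (_≟ᶜ_ {n}) using () renaming (_∈?_ to _∈ᶜ?_)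

  traverse-fixpointFree : NoShortChord → ∀ c → traverse B c ≢ c
  traverse-fixpointFree noShort (corner p true) eq =
    noShort p (cong position (trans (sym (edgeMove-corner (nextF p) false)) eq))
  traverse-fixpointFree noShort (corner p false) eq =
    noShort (prevF p) (trans (cong partner (nextF-prevF p))
                             (partner-swap (cong position (trans (sym (edgeMove-corner (prevF p) true)) eq))))

  quad : Corner n → List (Corner n)
  quad c = c ∷ arcMove c ∷ traverse B c ∷ arcMove (traverse B c) ∷ []

  quad-sameFace : ∀ {c d} → d ∈ quad c → SameFace c d
  quad-sameFace (here refl)                         = 0 , inj₁ refl
  quad-sameFace (there (here refl))                 = 0 , inj₂ refl
  quad-sameFace (there (there (here refl)))         = 1 , inj₁ refl
  quad-sameFace (there (there (there (here refl)))) = 1 , inj₂ refl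

  quad-unique : NoShortChord → ∀ c → Unique (quad c)
  quad-unique noShort c =
      (c≢τc ∷ c≢Tc ∷ (λ eq → σ-fixpointFree (sym (trans (cong arcMove eq) (arcMove-involutive _)))) ∷ [])
    ∷ ((λ eq → σ-fixpointFree (sym eq)) ∷ (λ eq → c≢Tc (arcMove-injective eq)) ∷ [])
    ∷ ((λ eq → arcMove-fixpointFree _ (sym eq)) ∷ [])
    ∷ [] ∷ []
    where
    σ-fixpointFree = edgeMove-fixpointFree (arcMove c)
    c≢τc : c ≢ arcMove c
    c≢τc eq = arcMove-fixpointFree c (sym eq)
    c≢Tc : c ≢ traverse B c
    c≢Tc eq = traverse-fixpointFree noShort c (sym eq)

  minima : List (Corner n)
  minima = filter (λ c → T? (isComponentMin B c)) (allCorners n)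

  minima-unique : Unique minima
  minima-unique = Unique.filter⁺ _ (allCorners-unique n)

  quads : List (Corner n)
  quads = concatMap quad minima

  length-quads : ∀ cs → length (concatMap quad cs) ≡ 4 * length cs
  length-quads []       = refl
  length-quads (c ∷ cs) = trans (cong (4 +_) (length-quads cs)) (sym (*-suc 4 (length cs)))

  ∈-quads⁻ : ∀ {d} → d ∈ quads → ∃[ c ] T (isComponentMin B c) × d ∈ quad c
  ∈-quads⁻ d∈ with ∈-concat⁻′ (map quad minima) d∈
  ... | _ , d∈q , q∈ with ∈-map⁻ quad q∈
  ... | c , c∈minima , refl = c , proj₂ (∈-filter⁻ (λ c → T? (isComponentMin B c)) {xs = allCorners n} c∈minima) , d∈q

  quads-unique : NoShortChord → Unique quads
  quads-unique noShort = concatMap-unique (All.tabulate (λ {c} _ → quad-unique noShort c))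
                                          (disjoint minima-unique (all-filter _ (allCorners n)))
    where
    disjoint : ∀ {cs} → Unique cs → All (T ∘ isComponentMin B) cs → AllPairs (λ c c′ → Disjoint (quad c) (quad c′)) cs
    disjoint []              []            = []
    disjoint (c∉cs ∷ unique) (min ∷ mins) =
      All.zipWith (λ (c≢c′ , min′) {_} (d∈ , d∈′) →
                     c≢c′ (componentMin-unique min min′ (quad-sameFace d∈) (quad-sameFace d∈′)))
                  (c∉cs , mins)
      ∷ disjoint unique mins

  Unique⇒length≤4n : ∀ {cs : List (Corner n)} → Unique cs → length cs ≤ 4 * n
  Unique⇒length≤4n = Unique⇒length≤ cornerIndex cornerIndex-injective

  -- Each boundary component contains the four distinct corners of the quad of its minimum.
  faces≤n : NoShortChord → faces B ≤ n
  faces≤n noShort = *-cancelˡ-≤ 4 (subst (_≤ 4 * n) (length-quads minima) (Unique⇒length≤4n (quads-unique noShort)))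

  -- traverse = σ ∘ τ for the involutions σ = edgeMove B and τ = arcMove, so traverse² = id says
  -- that σ and τ commute.
  traverse²-arcMove : ∀ c → traverse B (traverse B c) ≡ c → traverse B (traverse B (arcMove c)) ≡ arcMove c
  traverse²-arcMove c T²c≡c = begin
    σ (τ (σ (τ (τ c))))  ≡⟨ cong (σ ∘ τ ∘ σ) (arcMove-involutive c) ⟩
    σ (τ (σ c))          ≡⟨ cong σ τσc≡στc ⟩
    σ (σ (τ c))          ≡⟨ edgeMove-involutive (τ c) ⟩
    τ c                  ∎
    where
    open ≡-Reasoning
    σ = edgeMove B
    τ = arcMove
    τσc≡στc : τ (σ c) ≡ σ (τ c)
    τσc≡στc = begin
      τ (σ c)                  ≡⟨ cong (τ ∘ σ) (sym T²c≡c) ⟩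
      τ (σ (σ (τ (σ (τ c)))))  ≡⟨ cong τ (edgeMove-involutive _) ⟩
      τ (τ (σ (τ c)))          ≡⟨ arcMove-involutive _ ⟩
      σ (τ c)                  ∎

  -- With f = n the quads exhaust all 4n corners, so every boundary component is a quad.
  module _ (noShort : NoShortChord) (faces≡n : faces B ≡ n) where

    quads-cover : ∀ d → d ∈ quads
    quads-cover d with d ∈ᶜ? quads
    ... | yes d∈ = d∈
    ... | no d∉  = contradiction (Unique⇒length≤4n (d∉quads ∷ quads-unique noShort)) (<⇒≱ (begin-strict
      4 * n                  ≡⟨ cong (4 *_) (sym faces≡n) ⟩
      4 * length minima      ≡⟨ sym (length-quads minima) ⟩
      length quads           <⟨ n<1+n _ ⟩
      length (d ∷ quads)     ∎))
      where
      open ≤-Reasoning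
      d∉quads : All (d ≢_) quads
      d∉quads = All.tabulate (λ d′∈ d≡d′ → d∉ (subst (_∈ quads) (sym d≡d′) d′∈))

    traverse²-componentMin : ∀ {c} → T (isComponentMin B c) → traverse B (traverse B c) ≡ c
    traverse²-componentMin {c} min with ∈-quads⁻ (quads-cover (traverse B (traverse B c)))
    ... | c′ , min′ , T²c∈ with componentMin-unique min′ min (quad-sameFace T²c∈) (2 , inj₁ refl)
    ... | refl with T²c∈
    ... | here eq                         = eq
    ... | there (here eq)                 = contradiction (trans (sym (edgeMove-involutive _)) (cong (edgeMove B) eq))
                                                        (arcMove-fixpointFree (traverse B c))
    ... | there (there (here eq))         = contradiction (traverse-injective eq) (traverse-fixpointFree noShort c)
    ... | there (there (there (here eq))) = contradiction eq (edgeMove-fixpointFree _)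

    faces≡n⇒traverse-involutive : ∀ c → traverse B (traverse B c) ≡ c
    faces≡n⇒traverse-involutive d with ∈-quads⁻ (quads-cover d)
    ... | c , min , here refl                         = traverse²-componentMin min
    ... | c , min , there (here refl)                 = traverse²-arcMove c (traverse²-componentMin min)
    ... | c , min , there (there (here refl))         = cong (traverse B) (traverse²-componentMin min)
    ... | c , min , there (there (there (here refl))) =
      traverse²-arcMove (traverse B c) (cong (traverse B) (traverse²-componentMin min))


Reachable-from-isolated : ∀ {n} (G : Graph n) {i j} → (∀ k → adj G i k ≡ false) → Reachable G i j → i ≡ j
Reachable-from-isolated G isolated here           = refl
Reachable-from-isolated G isolated (step i~k _) = contradiction (trans (sym i~k) (isolated _)) λ ()

connected⇒noShortChord : ∀ {k} (G : Graph (suc (suc k))) → Connected G → (B : Bouquet (suc (suc k))) →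
  (∀ i j → adj G i j ≡ interlaced B i j) → Chords.NoShortChord B
connected⇒noShortChord G connected B adj≡interlaced q short =
  punchInᵢ≢i i Fin.zero (sym (Reachable-from-isolated G isolated (connected i (Fin.punchIn i Fin.zero))))
  where
  open Chords B
  i = chord q
  isolated : ∀ j → adj G i j ≡ false
  isolated j with j Fin.≟ i
  ... | yes refl = irrefl G i
  ... | no j≢i   = trans (adj≡interlaced i j) (shortChord-isolated short j j≢i)

-- Diametral chord diagrams

module Diameters {n : ℕ} (B : Bouquet n) where

  open Chords B

  Diametral : Set
  Diametral = ∀ p → toℕ (partner p) ≡ toℕ p + n ⊎ toℕ (partner p) + n ≡ toℕ p

  diametral-low-end : Diametral → ∀ p → ∃[ q ] chord q ≡ chord p × toℕ q < n × toℕ (partner q) ≡ toℕ q + n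
  diametral-low-end diametral p with diametral p
  ... | inj₁ p′≡p+n = p , refl , +-cancelʳ-< n _ _ (subst (_< n + n) p′≡p+n (toℕ<n (partner p))) , p′≡p+n
  ... | inj₂ p′+n≡p = partner p , chord-partner p ,
        +-cancelʳ-< n _ _ (subst (_< n + n) (sym p′+n≡p) (toℕ<n p)) ,
        trans (cong toℕ (partner-involutive p)) (sym p′+n≡p)

  diametral⇒interlaced : Diametral → ∀ i j → i ≢ j → interlaced B i j ≡ true
  diametral⇒interlaced diametral i j i≢j
    with diametral-low-end diametral (pos B (i , false)) | diametral-low-end diametral (pos B (j , false))
  ... | p , chord-p , p<n , p′≡p+n | q , chord-q , q<n , q′≡q+n = begin
    interlaced B i j
      ≡⟨ cong₂ (interlaced B) (sym chord-p≡i) (sym chord-q≡j) ⟩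
    interlaced B (chord p) (chord q)
      ≡⟨ interlaced-chords p q ⟩
    strictlyBetween (toℕ q) (toℕ p) (toℕ (partner p)) xor strictlyBetween (toℕ (partner q)) (toℕ p) (toℕ (partner p))
      ≡⟨ cong₂ (λ p′ q′ → strictlyBetween (toℕ q) (toℕ p) p′ xor strictlyBetween q′ (toℕ p) p′) p′≡p+n q′≡q+n ⟩
    strictlyBetween (toℕ q) (toℕ p) (toℕ p + n) xor strictlyBetween (toℕ q + n) (toℕ p) (toℕ p + n)
      ≡⟨ diameters-cross p<n q<n (λ p≡q → i≢j (trans (sym chord-p≡i) (trans (cong chord (toℕ-injective p≡q))
                                                                            chord-q≡j))) ⟩
    true ∎
    where
    open ≡-Reasoning
    chord-p≡i : chord p ≡ i
    chord-p≡i = trans chord-p (cong proj₁ (word-pos B (i , false)))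
    chord-q≡j : chord q ≡ j
    chord-q≡j = trans chord-q (cong proj₁ (word-pos B (j , false)))

module CompleteDiagram {k : ℕ} (B : Bouquet (suc k)) (complete : ∀ i j → i ≢ j → interlaced B i j ≡ true) where

  open Chords B
  open Diameters B

  n = suc k

  -- Every other chord has exactly one end strictly inside the chord from p to its partner, so
  -- the inside consists of exactly n − 1 positions.
  module _ (p : Fin (n + n)) (p<p′ : toℕ p < toℕ (partner p)) where

    Inside : Fin (n + n) → Set
    Inside u = toℕ p < toℕ u × toℕ u < toℕ (partner p)

    inside-other-chord : ∀ {u} → Inside u → chord p ≢ chord u
    inside-other-chord (p<u , u<p′) eq with same-chord p _ (sym eq)
    ... | inj₁ refl = <-irrefl refl p<u
    ... | inj₂ refl = <-irrefl refl u<p′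

    inside-end : ∀ j → chord p ≢ j → ∃[ u ] chord u ≡ j × Inside u
    inside-end j i≢j with xor-true⇒ _ _ (trans (sym (interlaced-at p j)) (complete (chord p) j i≢j))
    ... | inj₁ between = pos B (j , false) , cong proj₁ (word-pos B _) , strictlyBetween⇒ p<p′ between
    ... | inj₂ between = pos B (j , true)  , cong proj₁ (word-pos B _) , strictlyBetween⇒ p<p′ between

    not-both-inside : ∀ {u} → Inside u → ¬ Inside (partner u)
    not-both-inside {u} (p<u , u<p′) (p<v , v<p′) = contradiction (begin
      true
        ≡⟨ sym (complete (chord p) (chord u) (inside-other-chord (p<u , u<p′))) ⟩
      interlaced B (chord p) (chord u)
        ≡⟨ interlaced-chords p u ⟩
      strictlyBetween (toℕ u) (toℕ p) (toℕ (partner p)) xor strictlyBetween (toℕ (partner u)) (toℕ p) (toℕ (partner p))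
        ≡⟨ cong₂ _xor_ (strictlyBetween-true p<u u<p′) (strictlyBetween-true p<v v<p′) ⟩
      false ∎) λ ()
      where open ≡-Reasoning

    width = toℕ (partner p) ∸ suc (toℕ p)

    inside< : (t : Fin width) → suc (toℕ p) + toℕ t < toℕ (partner p)
    inside< t = subst (suc (toℕ p) + toℕ t <_) (m+[n∸m]≡n p<p′) (+-monoʳ-< (suc (toℕ p)) (toℕ<n t))

    inside : Fin width → Fin (n + n)
    inside t = fromℕ< (<-trans (inside< t) (toℕ<n (partner p)))

    toℕ-inside : ∀ t → toℕ (inside t) ≡ suc (toℕ p) + toℕ t
    toℕ-inside t = toℕ-fromℕ< (<-trans (inside< t) (toℕ<n (partner p)))

    inside-Inside : ∀ t → Inside (inside t)
    inside-Inside t rewrite toℕ-inside t = s≤s (m≤m+n _ _) , inside< t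

    inside-injective : ∀ {t t′} → inside t ≡ inside t′ → t ≡ t′
    inside-injective {t} {t′} eq = toℕ-injective (+-cancelˡ-≡ (suc (toℕ p)) _ _ (begin
      suc (toℕ p) + toℕ t    ≡⟨ sym (toℕ-inside t) ⟩
      toℕ (inside t)         ≡⟨ cong toℕ eq ⟩
      toℕ (inside t′)        ≡⟨ toℕ-inside t′ ⟩
      suc (toℕ p) + toℕ t′   ∎))
      where open ≡-Reasoning

    chordOfInside : Fin width → Fin k
    chordOfInside t = Fin.punchOut (inside-other-chord (inside-Inside t))

    chordOfInside-injective : ∀ {t t′} → chordOfInside t ≡ chordOfInside t′ → t ≡ t′
    chordOfInside-injective {t} {t′} eq with same-chord (inside t) (inside t′)
      (sym (punchOut-injective (inside-other-chord (inside-Inside t)) (inside-other-chord (inside-Inside t′)) eq))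
    ... | inj₁ same     = inside-injective (sym same)
    ... | inj₂ partners = contradiction (subst Inside partners (inside-Inside t′)) (not-both-inside (inside-Inside t))

    insideOfChord : Fin k → Fin width
    insideOfChord t with inside-end (Fin.punchIn (chord p) t) (punchInᵢ≢i (chord p) t ∘ sym)
    ... | u , _ , p<u , u<p′ = fromℕ< (∸-monoˡ-< u<p′ p<u)

    insideOfChord-injective : ∀ {t t′} → insideOfChord t ≡ insideOfChord t′ → t ≡ t′
    insideOfChord-injective {t} {t′} eq
      with inside-end (Fin.punchIn (chord p) t) (punchInᵢ≢i (chord p) t ∘ sym)
         | inside-end (Fin.punchIn (chord p) t′) (punchInᵢ≢i (chord p) t′ ∘ sym)
    ... | u , chord-u , p<u , _ | u′ , chord-u′ , p<u′ , _ =
      punchIn-injective (chord p) t t′ (trans (sym chord-u) (trans (cong chord u≡u′) chord-u′))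
      where
      u≡u′ : u ≡ u′
      u≡u′ = toℕ-injective (∸-cancelʳ-≡ p<u p<u′ (trans (sym (toℕ-fromℕ< _)) (trans (cong toℕ eq) (toℕ-fromℕ< _))))

    width≡k : width ≡ k
    width≡k = ≤-antisym (injective⇒≤ chordOfInside-injective) (injective⇒≤ insideOfChord-injective)

    chord-length : toℕ (partner p) ≡ toℕ p + n
    chord-length = begin
      toℕ (partner p)             ≡⟨ sym (m+[n∸m]≡n p<p′) ⟩
      suc (toℕ p) + width         ≡⟨ cong (suc (toℕ p) +_) width≡k ⟩
      suc (toℕ p) + k             ≡⟨ sym (+-suc (toℕ p) k) ⟩
      toℕ p + n                   ∎
      where open ≡-Reasoning

  complete⇒diametral : Diametral
  complete⇒diametral p with <-cmp (toℕ p) (toℕ (partner p))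
  ... | tri< p<p′ _ _ = inj₁ (chord-length p p<p′)
  ... | tri≈ _ p≡p′ _ = contradiction (toℕ-injective (sym p≡p′)) (partner-fixpointFree p)
  ... | tri> _ _ p′<p = inj₂ (sym (subst (λ q → toℕ q ≡ toℕ (partner p) + n) p″≡p (chord-length (partner p) p′<p″)))
    where
    p″≡p = partner-involutive p
    p′<p″ = subst (λ q → toℕ (partner p) < toℕ q) (sym p″≡p) p′<p

module ShiftsAndReflections {k : ℕ} (B : Bouquet (suc k)) where

  open Chords B
  open Diameters B

  n = suc k
  N = n + n

  -- A partner map commuting with nextF is the rotation by c₀; being a fixed-point-free
  -- involution forces c₀ = n.
  c₀ : ℕ
  c₀ = toℕ (partner Fin.zero)

  Offset : Fin N → Set
  Offset p = toℕ (partner p) ≡ c₀ + toℕ p ⊎ toℕ (partner p) + N ≡ c₀ + toℕ p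

  offset-zero : Offset Fin.zero
  offset-zero = inj₁ (sym (+-identityʳ c₀))

  module _ (shift : ∀ p → partner (nextF p) ≡ nextF (partner p)) where

    offset-nextF : ∀ p → Offset p → Offset (nextF p)
    offset-nextF p offset-p with nextF-cases p
    ... | inj₂ (_ , next≡0) = subst Offset (toℕ-injective (sym next≡0)) offset-zero
    ... | inj₁ (p<last , next≡1+p) rewrite shift p | next≡1+p | +-suc c₀ (toℕ p)
      with nextF-cases (partner p) | offset-p
    ... | inj₁ (_ , next′≡1+p′) | inj₁ p′≡ = inj₁ (trans next′≡1+p′ (cong suc p′≡))
    ... | inj₁ (_ , next′≡1+p′) | inj₂ p′+N≡ = inj₂ (trans (cong (_+ N) next′≡1+p′) (cong suc p′+N≡))
    ... | inj₂ (p′≡last , next′≡0) | inj₁ p′≡ = inj₂ (trans (cong (_+ N) next′≡0) (cong suc (trans (sym p′≡last) p′≡)))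
    ... | inj₂ (p′≡last , next′≡0) | inj₂ p′+N≡ = contradiction p′+N≡ (<⇒≢ (begin-strict
      c₀ + toℕ p                  <⟨ +-mono-≤-< (≤-pred (toℕ<n (partner Fin.zero))) p<last ⟩
      (k + n) + (k + n)           <⟨ +-monoʳ-< (k + n) (n<1+n (k + n)) ⟩
      (k + n) + N                 ≡⟨ cong (_+ N) (sym p′≡last) ⟩
      toℕ (partner p) + N         ∎) ∘ sym)
      where open ≤-Reasoning

    offset : ∀ p → Offset p
    offset = nextF-induction Offset offset-zero offset-nextF

    c₀≡n : c₀ ≡ n
    c₀≡n with offset (partner Fin.zero) | cong toℕ (partner-involutive Fin.zero)
    ... | inj₁ 0″≡c₀+c₀ | 0″≡0 =
      contradiction (toℕ-injective (m+n≡0⇒m≡0 c₀ (sym (trans (sym 0″≡0) 0″≡c₀+c₀)))) (partner-fixpointFree Fin.zero)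
    ... | inj₂ 0″+N≡c₀+c₀ | 0″≡0 = sym (double-injective n c₀ (trans (cong (_+ N) (sym 0″≡0)) 0″+N≡c₀+c₀))
      where
      double-injective : ∀ a b → a + a ≡ b + b → a ≡ b
      double-injective a b eq with <-cmp a b
      ... | tri< a<b _ _ = contradiction eq (<⇒≢ (+-mono-< a<b a<b))
      ... | tri≈ _ a≡b _ = a≡b
      ... | tri> _ _ b<a = contradiction (sym eq) (<⇒≢ (+-mono-< b<a b<a))

    shift⇒diametral : Diametral
    shift⇒diametral p with offset p
    ... | inj₁ p′≡ = inj₁ (trans p′≡ (trans (cong (_+ toℕ p) c₀≡n) (+-comm n (toℕ p))))
    ... | inj₂ p′+N≡ = inj₂ (+-cancelʳ-≡ n _ _ (begin
      toℕ (partner p) + n + n     ≡⟨ +-assoc (toℕ (partner p)) n n ⟩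
      toℕ (partner p) + N         ≡⟨ p′+N≡ ⟩
      c₀ + toℕ p                  ≡⟨ cong (_+ toℕ p) c₀≡n ⟩
      n + toℕ p                   ≡⟨ +-comm n (toℕ p) ⟩
      toℕ p + n                   ∎))
      where open ≡-Reasoning

  -- A partner map reversing nextF is the reflection p ↦ c₀ − p, whose middle chord has equal
  -- or adjacent ends.
  module _ (reflection : ∀ p → partner (nextF p) ≡ prevF (partner p)) where

    reflection-sum : ∀ j p → toℕ p ≡ j → j ≤ c₀ → toℕ (partner p) + j ≡ c₀
    reflection-sum zero    p p≡0   _      rewrite toℕ-injective {j = Fin.zero} p≡0 = +-identityʳ c₀
    reflection-sum (suc j) p p≡1+j 1+j≤c₀
      with toℕ (partner (prevF p)) in q′≡
         | reflection-sum j (prevF p) (toℕ-prevF-suc p p≡1+j) (≤-trans (n≤1+n j) 1+j≤c₀)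
    ... | zero  | j≡c₀ = contradiction (≤-trans 1+j≤c₀ (≤-reflexive (sym j≡c₀))) (n≮n j)
    ... | suc t | 1+t+j≡c₀ = begin
      toℕ (partner p) + suc j                  ≡⟨ cong (λ q → toℕ (partner q) + suc j) (sym (nextF-prevF p)) ⟩
      toℕ (partner (nextF (prevF p))) + suc j  ≡⟨ cong (λ q → toℕ q + suc j) (reflection (prevF p)) ⟩
      toℕ (prevF (partner (prevF p))) + suc j  ≡⟨ cong (_+ suc j) (toℕ-prevF-suc (partner (prevF p)) q′≡) ⟩
      t + suc j                                ≡⟨ +-suc t j ⟩
      suc t + j                                ≡⟨ 1+t+j≡c₀ ⟩
      c₀                                       ∎
      where open ≡-Reasoning

    reflection-at : ∀ {j} → j ≤ c₀ → ∃[ q ] toℕ q ≡ j × toℕ (partner q) + j ≡ c₀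
    reflection-at {j} j≤c₀ = q , toℕ-fromℕ< j<N , reflection-sum j q (toℕ-fromℕ< j<N) j≤c₀
      where
      j<N = <-≤-trans (s≤s j≤c₀) (toℕ<n (partner Fin.zero))
      q = fromℕ< j<N

    reflection⇒shortChord : ¬ NoShortChord
    reflection⇒shortChord noShort with parity c₀
    ... | j , inj₁ c₀≡j+j with reflection-at (subst (j ≤_) (sym c₀≡j+j) (m≤m+n j j))
    ... | q , q≡j , q′+j≡c₀ =
      partner-fixpointFree q (toℕ-injective (trans (+-cancelʳ-≡ j _ _ (trans q′+j≡c₀ c₀≡j+j)) (sym q≡j)))
    reflection⇒shortChord noShort | j , inj₂ c₀≡1+j+j
      with reflection-at (subst (j ≤_) (sym c₀≡1+j+j) (≤-trans (m≤m+n j j) (n≤1+n _)))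
    ... | q , q≡j , q′+j≡c₀ = noShort q (partner-swap (toℕ-injective (trans q′≡1+q (sym (toℕ-nextF-< q q<last)))))
      where
      q′≡1+q : toℕ (partner q) ≡ suc (toℕ q)
      q′≡1+q = trans (+-cancelʳ-≡ j _ _ (trans q′+j≡c₀ c₀≡1+j+j)) (cong suc (sym q≡j))
      q<last : toℕ q < k + n
      q<last = ≤-pred (subst (_< N) q′≡1+q (toℕ<n (partner q)))

  -- traverse² = id at the right corner of p ties the chord at nextF p to the chord at p.
  module _ (involutive : ∀ c → traverse B (traverse B c) ≡ c) where

    twisted-step : ∀ p → twistedAt (nextF p) ≡ true → twistedAt p ≡ true × partner (nextF p) ≡ nextF (partner p)
    twisted-step p twisted-q = tw-p , q′≡
      where
      open ≡-Reasoning
      q = nextF p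
      r = prevF (partner q)
      back : corner (partner r) (twistedAt r) ≡ corner p true
      back = begin
        corner (partner r) (twistedAt r)                     ≡⟨ sym (traverse-left (partner q)) ⟩
        traverse B (corner (partner q) false)                ≡⟨ cong (traverse B ∘ corner (partner q) ∘ not) (sym twisted-q) ⟩
        traverse B (corner (partner q) (not (twistedAt q)))  ≡⟨ cong (traverse B) (sym (traverse-right p)) ⟩
        traverse B (traverse B (corner p true))              ≡⟨ involutive _ ⟩
        corner p true                                        ∎
      r′≡p : partner r ≡ p
      r′≡p = cong position back
      tw-p : twistedAt p ≡ true
      tw-p = trans (cong twistedAt (sym r′≡p)) (trans (twistedAt-partner r) (cong side back))
      q′≡ : partner q ≡ nextF (partner p)
      q′≡ = trans (sym (nextF-prevF (partner q))) (cong nextF (sym (partner-swap r′≡p)))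

    untwisted-step : ∀ p → twistedAt (nextF p) ≡ false → twistedAt p ≡ false × partner (nextF p) ≡ prevF (partner p)
    untwisted-step p untwisted-q = tw-p , q′≡
      where
      open ≡-Reasoning
      q = nextF p
      r = nextF (partner q)
      back : corner (partner r) (not (twistedAt r)) ≡ corner p true
      back = begin
        corner (partner r) (not (twistedAt r))               ≡⟨ sym (traverse-right (partner q)) ⟩
        traverse B (corner (partner q) true)                 ≡⟨ cong (traverse B ∘ corner (partner q) ∘ not) (sym untwisted-q) ⟩
        traverse B (corner (partner q) (not (twistedAt q)))  ≡⟨ cong (traverse B) (sym (traverse-right p)) ⟩
        traverse B (traverse B (corner p true))              ≡⟨ involutive _ ⟩
        corner p true                                        ∎
      r′≡p : partner r ≡ p
      r′≡p = cong position back
      tw-p : twistedAt p ≡ false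
      tw-p = trans (cong twistedAt (sym r′≡p)) (trans (twistedAt-partner r) (not-injective (cong side back)))
      q′≡ : partner q ≡ prevF (partner p)
      q′≡ = trans (sym (prevF-nextF (partner q))) (cong prevF (sym (partner-swap r′≡p)))

    twistedAt-nextF : ∀ p → twistedAt (nextF p) ≡ twistedAt p
    twistedAt-nextF p with twistedAt (nextF p) in tw-q
    ... | true  = sym (proj₁ (twisted-step p tw-q))
    ... | false = sym (proj₁ (untwisted-step p tw-q))

    twistedAt-constant : ∀ p → twistedAt p ≡ twistedAt Fin.zero
    twistedAt-constant = nextF-induction _ refl (λ p tw-p → trans (twistedAt-nextF p) tw-p)

    traverse-involutive⇒diametral : NoShortChord → Diametral
    traverse-involutive⇒diametral noShort with twistedAt Fin.zero in tw₀
    ... | true  = shift⇒diametral (λ p → proj₂ (twisted-step p (trans (twistedAt-constant _) tw₀)))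
    ... | false =
      contradiction noShort (reflection⇒shortChord (λ p → proj₂ (untwisted-step p (trans (twistedAt-constant _) tw₀))))

-- The partial-Petrial polynomial

subsets-complete : ∀ n (A : Vec Bool n) → A ∈ subsets n
subsets-complete zero    []          = here refl
subsets-complete (suc n) (false ∷ A) = ∈-concat⁺′ (here refl)         (∈-map⁺ _ (subsets-complete n A))
subsets-complete (suc n) (true ∷ A)  = ∈-concat⁺′ (there (here refl)) (∈-map⁺ _ (subsets-complete n A))

module Coefficients {n : ℕ} (B : Bouquet n) where

  genus : Vec Bool n → ℕ
  genus A = eulerGenus (partialPetrial B A)

  petrialCoeff≡0 : ∀ g → (∀ A → genus A ≢ g) → petrialCoeff B g ≡ 0
  petrialCoeff≡0 g genus≢g =
    cong length (filter-none (λ A → genus A ≟ g) {subsets n} (All.tabulate (λ {A} _ → genus≢g A)))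

  petrialCoeff≢0 : ∀ A → petrialCoeff B (genus A) ≢ 0
  petrialCoeff≢0 A = n>0⇒n≢0 (∈⇒0<length (∈-filter⁺ (λ A′ → genus A′ ≟ genus A) (subsets-complete n A) refl))

  petrialCoeff≢0⇒ : ∀ g → petrialCoeff B g ≢ 0 → ∃[ A ] genus A ≡ g
  petrialCoeff≢0⇒ g = filter-nonempty (λ A → genus A ≟ g) (subsets n)

-- allCorners starts with the left corner at position 0, whose key is 0.
faces-positive : ∀ {k} (B : Bouquet (suc k)) → 1 ≤ faces B
faces-positive {k} B =
  ∈⇒0<length (∈-filter⁺ (λ c → T? (isComponentMin B c)) {xs = allCorners (suc k)} (here refl) first-min)
  where
  first-min : T (isComponentMin B (corner Fin.zero false))
  first-min = Faces.isComponentMin⇐ B {corner Fin.zero false} (λ _ → z≤n , z≤n)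

eulerGenus≤n : ∀ {k} (B : Bouquet (suc k)) → eulerGenus B ≤ suc k
eulerGenus≤n {k} B = ∸-monoʳ-≤ (2 + suc k) (s≤s (faces-positive B))

eulerGenus-faces : ∀ {n} (B : Bouquet n) → faces B ≤ n → eulerGenus B ≡ suc (n ∸ faces B)
eulerGenus-faces B faces≤n = +-∸-assoc 1 faces≤n

eulerGenus≡1⇒faces≡n : ∀ {n} (B : Bouquet n) → faces B ≤ n → eulerGenus B ≡ 1 → faces B ≡ n
eulerGenus≡1⇒faces≡n B faces≤n genus≡1 =
  ≤-antisym faces≤n (m∸n≡0⇒m≤n (suc-injective (trans (sym (eulerGenus-faces B faces≤n)) genus≡1)))

petrialCoeff-zero : ∀ {n} (B : Bouquet n) → Chords.NoShortChord B → petrialCoeff B 0 ≡ 0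
petrialCoeff-zero B noShort = Coefficients.petrialCoeff≡0 B 0 λ A genus≡0 →
  1+n≢0 (trans (sym (eulerGenus-faces _ (Faces.faces≤n (partialPetrial B A) noShort))) genus≡0)

petrialCoeff-above : ∀ {k} (B : Bouquet (suc k)) g → suc k < g → petrialCoeff B g ≡ 0
petrialCoeff-above B g n<g = Coefficients.petrialCoeff≡0 B g λ A genus≡g →
  <⇒≱ n<g (subst (_≤ _) genus≡g (eulerGenus≤n (partialPetrial B A)))

-- The staircase partial Petrial

module Staircase {k : ℕ} (B : Bouquet (suc (suc k))) (diametral : Diameters.Diametral B)
                 (s : ℕ) (s<n : s < suc (suc k)) where

  open Chords B using (chord; partner; chord-ends)

  n = suc (suc k)

  -- A loop of B′ is twisted exactly when its lower end is at least s.
  twist : Fin n → Bool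
  twist i = twisted B i xor (s ≤ᵇ toℕ (pos B (i , false)) % n)

  twists : Vec Bool n
  twists = tabulate twist

  B′ : Bouquet n
  B′ = partialPetrial B twists

  open Chords B′ using (twistedAt; traverse-right; traverse-left)
  open Faces B′ using (SameFace; KeyMinimalAt; componentMin-minimal; isComponentMin⇐)

  -- The positions m and m + n (m < n) are the two ends of one chord.
  lift : ℕ → Bool → ℕ
  lift m false = m
  lift m true  = m + n

  lift%n : ∀ {m} h → m < n → lift m h % n ≡ m
  lift%n false m<n = m<n⇒m%n≡m m<n
  lift%n {m} true  m<n = trans ([m+n]%n≡m%n m n) (m<n⇒m%n≡m m<n)

  partner-lift : ∀ {p m} h → m < n → toℕ p ≡ lift m h → toℕ (partner p) ≡ lift m (not h)
  partner-lift {p} false m<n p≡m with diametral p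
  ... | inj₁ p′≡p+n = trans p′≡p+n (cong (_+ n) p≡m)
  ... | inj₂ p′+n≡p = contradiction (subst (_< n) (sym p≡m) m<n) (≤⇒≯ (subst (n ≤_) p′+n≡p (m≤n+m n _)))
  partner-lift {p} true  m<n p≡m+n with diametral p
  ... | inj₁ p′≡p+n = contradiction (toℕ<n (partner p))
                                    (≤⇒≯ (subst (n + n ≤_) (sym p′≡p+n) (+-monoˡ-≤ n (subst (n ≤_) (sym p≡m+n) (m≤n+m n _)))))
  ... | inj₂ p′+n≡p = +-cancelʳ-≡ n _ _ (trans p′+n≡p p≡m+n)

  nextF-lift : ∀ {p m} h → suc m < n → toℕ p ≡ lift m h → toℕ (nextF p) ≡ lift (suc m) h
  nextF-lift {p} false 1+m<n p≡ = trans (toℕ-nextF-< p (subst (_< suc k + n) (sym p≡) below-last)) (cong suc p≡)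
    where below-last = <-≤-trans (≤-pred 1+m<n) (m≤m+n (suc k) n)
  nextF-lift {p} true  1+m<n p≡ = trans (toℕ-nextF-< p (subst (_< suc k + n) (sym p≡) below-last)) (cong suc p≡)
    where below-last = +-monoˡ-< n (≤-pred 1+m<n)

  prevF-lift : ∀ {p m} h → toℕ p ≡ lift (suc m) h → toℕ (prevF p) ≡ lift m h
  prevF-lift {p} false p≡ = toℕ-prevF-suc {suc k + n} p p≡
  prevF-lift {p} true  p≡ = toℕ-prevF-suc {suc k + n} p p≡

  twistedAt-lift : ∀ {p m} h → m < n → toℕ p ≡ lift m h → twistedAt p ≡ (s ≤ᵇ m)
  twistedAt-lift {p} {m} h m<n p≡ = begin
    twisted B (chord p) xor lookupᵛ twists (chord p)
      ≡⟨ cong (twisted B (chord p) xor_) (lookup∘tabulate twist (chord p)) ⟩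
    twisted B (chord p) xor (twisted B (chord p) xor (s ≤ᵇ toℕ (pos B (chord p , false)) % n))
      ≡⟨ sym (xor-assoc (twisted B (chord p)) _ _) ⟩
    (twisted B (chord p) xor twisted B (chord p)) xor (s ≤ᵇ toℕ (pos B (chord p , false)) % n)
      ≡⟨ cong (_xor (s ≤ᵇ toℕ (pos B (chord p , false)) % n)) (xor-same (twisted B (chord p))) ⟩
    s ≤ᵇ toℕ (pos B (chord p , false)) % n
      ≡⟨ cong (s ≤ᵇ_) low-level ⟩
    s ≤ᵇ m ∎
    where
    open ≡-Reasoning
    low-level : toℕ (pos B (chord p , false)) % n ≡ m
    low-level with chord-ends p
    ... | inj₁ (e₀ , _) = trans (cong (λ q → toℕ q % n) e₀) (trans (cong (_% n) p≡) (lift%n h m<n))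
    ... | inj₂ (e₀ , _) =
      trans (cong (λ q → toℕ q % n) e₀) (trans (cong (_% n) (partner-lift h m<n p≡)) (lift%n (not h) m<n))

  data Located (c : Corner n) (m : ℕ) (h b : Bool) : Set where
    located : toℕ (position c) ≡ lift m h → side c ≡ b → Located c m h b

  located-unique : ∀ {c d m h b} → Located c m h b → Located d m h b → c ≡ d
  located-unique {corner x _} {corner y _} (located x≡ refl) (located y≡ refl) =
    cong (λ z → corner z _) (toℕ-injective (trans x≡ (sym y≡)))

  step-right : ∀ {c m h} → Located c m h true → suc m < n → Located (traverse B′ c) (suc m) (not h) (not (s ≤ᵇ suc m))
  step-right {corner x _} {m} {h} (located x≡ refl) 1+m<n =
    subst (λ c → Located c (suc m) (not h) (not (s ≤ᵇ suc m))) (sym (traverse-right x))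
          (located (partner-lift h 1+m<n next≡) (cong not (twistedAt-lift h 1+m<n next≡)))
    where next≡ = nextF-lift h 1+m<n x≡

  step-left : ∀ {c m h} → Located c (suc m) h false → m < n → Located (traverse B′ c) m (not h) (s ≤ᵇ m)
  step-left {corner x _} {m} {h} (located x≡ refl) m<n =
    subst (λ c → Located c m (not h) (s ≤ᵇ m)) (sym (traverse-left x))
          (located (partner-lift h m<n prev≡) (twistedAt-lift h m<n prev≡))
    where prev≡ = prevF-lift h x≡

  arc-right : ∀ {c m h} → Located c m h true → suc m < n → Located (arcMove c) (suc m) h false
  arc-right {corner x _} {m} {h} (located x≡ refl) 1+m<n = located (nextF-lift h 1+m<n x≡) refl

  arc-left : ∀ {c m h} → Located c (suc m) h false → Located (arcMove c) m h true
  arc-left {corner x _} {m} {h} (located x≡ refl) = located (prevF-lift h x≡) refl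

  step-up : ∀ {c m h} → Located c m h true → suc m < s → Located (traverse B′ c) (suc m) (not h) true
  step-up c-at 1+m<s = subst (Located _ _ _) (cong not (≤ᵇ-false 1+m<s)) (step-right c-at (<-trans 1+m<s s<n))

  step-turn : ∀ {c m h} → Located c m h true → suc m ≡ s → Located (traverse B′ c) (suc m) (not h) false
  step-turn c-at 1+m≡s = subst (Located _ _ _) (cong not (≤ᵇ-true (≤-reflexive (sym 1+m≡s))))
                               (step-right c-at (subst (_< n) (sym 1+m≡s) s<n))

  step-down : ∀ {c m h} → Located c (suc m) h false → m < s → Located (traverse B′ c) m (not h) false
  step-down c-at m<s = subst (Located _ _ _) (≤ᵇ-false m<s) (step-left c-at (<-trans m<s s<n))

  cornerKey-located : ∀ {c m h b} → Located c m h b → cornerKey c ≡ 2 * lift m h + bit b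
  cornerKey-located {corner x _} (located x≡ refl) = cong (λ a → 2 * a + _) x≡

  cornerKey-located-< : ∀ {c d m h b m′ h′ b′} → Located c m h b → Located d m′ h′ b′ → lift m h < lift m′ h′ →
    cornerKey c < cornerKey d
  cornerKey-located-< {b = b} {b′ = b′} c-at d-at lift< =
    subst₂ _<_ (sym (cornerKey-located c-at)) (sym (cornerKey-located d-at)) (doubled-< b b′ lift<)

  below-s : ∀ {m d} → m + suc d ≡ s → m < s
  below-s {m} m+1+d≡s = subst (m <_) m+1+d≡s (m<m+n m (s≤s z≤n))

  -- From the right corner at level m < s the boundary walk climbs to level s, turns, and
  -- descends to the left corner at level m.
  mirror : ∀ d {c m h} → m + suc d ≡ s → Located c m h true → ∃[ K ] Located (iterate (traverse B′) K c) m h false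
  mirror zero {c} {m} {h} m+1≡s c-at = 2 , subst (λ h → Located _ m h false) (not-involutive h)
    (step-down (step-turn c-at (trans (+-comm 1 m) m+1≡s)) (below-s m+1≡s))
  mirror (suc d) {c} {m} {h} m+2+d≡s c-at =
    let K , back-at = mirror d m+1+1+d≡s (step-up c-at (below-s m+1+1+d≡s)) in
    suc (suc K) , subst₂ (λ e h → Located e m h false)
                         (cong (traverse B′) (iterate-suc (traverse B′) K c)) (not-involutive h)
                         (step-down back-at (below-s m+2+d≡s))
    where m+1+1+d≡s = trans (sym (+-suc m (suc d))) m+2+d≡s

  isMin : Corner n → Bool
  isMin = isComponentMin B′

  not-min : ∀ {c d} → SameFace c d → cornerKey d < cornerKey c → ¬ T (isMin c)
  not-min c~d d<c min = <⇒≱ d<c (componentMin-minimal min c~d)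

  left-min : ∀ x → toℕ x ≡ 0 → T (isMin (corner x false))
  left-min x x≡0 = isComponentMin⇐ {corner x false} (λ _ → key≤ _ , key≤ _)
    where
    key≤ : ∀ v → cornerKey {n} (corner x false) ≤ v
    key≤ v = subst (_≤ v) (sym (cong (λ a → 2 * a + 0) x≡0)) z≤n

  left-not-min : ∀ x {t} → toℕ x ≡ suc t → ¬ T (isMin (corner x false))
  left-not-min x x≡1+t = not-min {corner x false} (0 , inj₂ refl)
    (cornerKey-<-position {n} true false (subst₂ _<_ (sym (toℕ-prevF-suc {suc k + n} x x≡1+t)) (sym x≡1+t) (n<1+n _)))

  right-not-min-below : ∀ x → toℕ x < s → ¬ T (isMin (corner x true))
  right-not-min-below x x<s with mirror (s ∸ suc (toℕ x)) (trans (+-suc (toℕ x) _) (m+[n∸m]≡n x<s)) c-at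
    where
    c-at : Located (corner x true) (toℕ x) false true
    c-at = located refl refl
  ... | K , back-at = not-min {corner x true} (K , inj₁ refl)
    (subst (_< cornerKey {n} (corner x true)) (sym (cornerKey-located back-at)) (+-monoʳ-< (2 * toℕ x) (s≤s z≤n)))

  right-min : ∀ x → s ≤ toℕ x → toℕ x < suc k → T (isMin (corner x true))
  right-min x s≤x x<1+k = isComponentMin⇐ {c} keys
    where
    c = corner x true
    c-at : Located c (toℕ x) false true
    c-at = located refl refl
    1+x<n : suc (toℕ x) < n
    1+x<n = s≤s x<1+k
    d = traverse B′ c
    d-at : Located d (suc (toℕ x)) true false
    d-at = subst (Located _ _ _) (cong not (≤ᵇ-true (≤-trans s≤x (n≤1+n _)))) (step-right c-at 1+x<n)
    Td≡c : traverse B′ d ≡ c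
    Td≡c = located-unique (subst (Located _ _ _) (≤ᵇ-true s≤x) (step-left d-at (<-trans (n<1+n _) 1+x<n))) c-at
    orbit : ∀ K → iterate (traverse B′) K c ≡ c ⊎ iterate (traverse B′) K c ≡ d
    orbit zero = inj₁ refl
    orbit (suc K) with orbit K
    ... | inj₁ at-c = inj₂ (cong (traverse B′) at-c)
    ... | inj₂ at-d = inj₁ (trans (cong (traverse B′) at-d) Td≡c)
    c≤ : ∀ {e m h b} → Located e m h b → toℕ x < lift m h → cornerKey c ≤ cornerKey e
    c≤ e-at x< = <⇒≤ (cornerKey-located-< c-at e-at x<)
    keys : ∀ K → KeyMinimalAt c K
    keys K with orbit K
    ... | inj₁ at-c rewrite at-c = ≤-refl , c≤ (arc-right c-at 1+x<n) (n<1+n _)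
    ... | inj₂ at-d rewrite at-d = c≤ d-at (<-≤-trans (n<1+n _) (m≤m+n _ n)) , c≤ (arc-left d-at) (m<m+n _ (s≤s z≤n))

  right-not-min-above : ∀ x → suc k ≤ toℕ x → ¬ T (isMin (corner x true))
  right-not-min-above x 1+k≤x = not-min {corner x true} (1 , inj₁ refl)
    (subst (_< cornerKey {n} (corner x true)) (cong cornerKey (sym (traverse-right x)))
           (cornerKey-<-position {n} _ true next′<x))
    where
    next′<x : toℕ (partner (nextF x)) < toℕ x
    next′<x with nextF-cases x | diametral (nextF x)
    ... | inj₁ (_ , next≡1+x) | inj₁ next′≡next+n =
      contradiction (toℕ<n (partner (nextF x)))
                    (≤⇒≯ (subst (n + n ≤_) (sym next′≡next+n) (+-monoˡ-≤ n (subst (n ≤_) (sym next≡1+x) (s≤s 1+k≤x)))))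
    ... | inj₁ (_ , next≡1+x) | inj₂ next′+n≡next = subst (toℕ (partner (nextF x)) <_)
      (suc-injective (trans (sym (+-suc _ (suc k))) (trans next′+n≡next next≡1+x))) (m<m+n _ (s≤s z≤n))
    ... | inj₂ (x≡last , next≡0) | inj₁ next′≡next+n =
      subst₂ _<_ (sym (trans next′≡next+n (cong (_+ n) next≡0))) (sym x≡last) (m<n+m n (s≤s z≤n))
    ... | inj₂ (_ , next≡0) | inj₂ next′+n≡next = contradiction (trans next′+n≡next next≡0) (m+1+n≢0 _)


  isMin-left : ∀ x → isMin (corner x false) ≡ (toℕ x ≡ᵇ 0)
  isMin-left x = go (toℕ x) refl
    where
    go : ∀ t → toℕ x ≡ t → isMin (corner x false) ≡ (t ≡ᵇ 0)
    go zero    x≡0   = Equivalence.to T-≡ (left-min x x≡0)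
    go (suc t) x≡1+t = ¬T⇒≡false (left-not-min x x≡1+t)

  isMin-right : ∀ x → isMin (corner x true) ≡ (s ≤ᵇ toℕ x) ∧ (toℕ x <ᵇ suc k)
  isMin-right x with s ≤? toℕ x
  ... | no s≰x = trans (¬T⇒≡false (right-not-min-below x (≰⇒> s≰x))) (sym (cong (_∧ _) (≤ᵇ-false (≰⇒> s≰x))))
  ... | yes s≤x with toℕ x <? suc k
  ...   | yes x<1+k = trans (Equivalence.to T-≡ (right-min x s≤x x<1+k)) (sym (cong₂ _∧_ (≤ᵇ-true s≤x) (<ᵇ-true x<1+k)))
  ...   | no x≮1+k  = trans (¬T⇒≡false (right-not-min-above x (≮⇒≥ x≮1+k)))
                              (sym (cong₂ _∧_ (≤ᵇ-true s≤x) (<ᵇ-false (≮⇒≥ x≮1+k))))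

  faces-staircase : faces B′ ≡ suc (suc k ∸ s)
  faces-staircase = begin
    faces B′
      ≡⟨ count-allCorners isMin (λ { false t → t ≡ᵇ 0 ; true t → (s ≤ᵇ t) ∧ (t <ᵇ suc k) }) classify ⟩
    sumBelow (n + n) (λ t → bit (t ≡ᵇ 0) + bit ((s ≤ᵇ t) ∧ (t <ᵇ suc k)))
      ≡⟨ sumBelow-+ (n + n) (λ t → bit (t ≡ᵇ 0)) (λ t → bit ((s ≤ᵇ t) ∧ (t <ᵇ suc k))) ⟩
    sumBelow (n + n) (λ t → bit (t ≡ᵇ 0)) + sumBelow (n + n) (λ t → bit ((s ≤ᵇ t) ∧ (t <ᵇ suc k)))
      ≡⟨ cong₂ _+_ (cong suc (trans (sumBelow-const (suc k + n) (λ _ _ → refl)) (*-zeroʳ (suc k + n))))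
                   (sumBelow-interval (n + n) (≤-pred s<n) (≤-trans (n≤1+n (suc k)) (m≤m+n n n))) ⟩
    suc (suc k ∸ s) ∎
    where
    open ≡-Reasoning
    classify : ∀ x b → isMin (corner x b) ≡ _
    classify x false = isMin-left x
    classify x true  = isMin-right x

  eulerGenus-staircase : eulerGenus B′ ≡ suc s
  eulerGenus-staircase = begin
    (2 + n) ∸ (1 + faces B′)         ≡⟨ cong (λ f → (2 + n) ∸ (1 + f)) faces-staircase ⟩
    n ∸ (suc k ∸ s)                  ≡⟨ +-∸-assoc 1 (m∸n≤m (suc k) s) ⟩
    suc (suc k ∸ (suc k ∸ s))        ≡⟨ cong suc (m∸[m∸n]≡n (≤-pred s<n)) ⟩
    suc s                            ∎
    where open ≡-Reasoning

  petrialCoeff-staircase : petrialCoeff B (suc s) ≢ 0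
  petrialCoeff-staircase =
    subst (λ g → petrialCoeff B g ≢ 0) eulerGenus-staircase (Coefficients.petrialCoeff≢0 B twists)

theorem3p5 : (n : ℕ) → 2 ≤ n → (G : Graph n) → Connected G →
    (B : Bouquet n) → ((i j : Fin n) → adj G i j ≡ interlaced B i j) →
    (FullForm (petrialCoeff B) n ⇔ Complete G)
theorem3p5 (suc (suc k)) (s≤s (s≤s z≤n)) G connected B adj≡interlaced = mk⇔ fullForm⇒complete complete⇒fullForm
  where
  noShort = connected⇒noShortChord G connected B adj≡interlaced

  fullForm⇒complete : FullForm (petrialCoeff B) (suc (suc k)) → Complete G
  fullForm⇒complete (_ , _ , nonzero) i j i≢j with Coefficients.petrialCoeff≢0⇒ B 1 (nonzero 1 ≤-refl (s≤s z≤n))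
  ... | A , genus≡1 = trans (adj≡interlaced i j) (Diameters.diametral⇒interlaced B′ diametral i j i≢j)
    where
    B′ = partialPetrial B A
    faces≡n = eulerGenus≡1⇒faces≡n B′ (Faces.faces≤n B′ noShort) genus≡1
    involutive = Faces.faces≡n⇒traverse-involutive B′ noShort faces≡n
    diametral = ShiftsAndReflections.traverse-involutive⇒diametral B′ involutive noShort

  complete⇒fullForm : Complete G → FullForm (petrialCoeff B) (suc (suc k))
  complete⇒fullForm complete = petrialCoeff-zero B noShort , petrialCoeff-above B ,
    λ { (suc s) _ 1+s≤n → Staircase.petrialCoeff-staircase B diametral s 1+s≤n }
    where
    diametral = CompleteDiagram.complete⇒diametral B (λ i j i≢j → trans (sym (adj≡interlaced i j)) (complete i j i≢j))
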